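{- For all integers $k,\ell,m\ge0$, \[M^{(2)}_{k,\ell,m}=[x^ky^\ell z^m]\,F(x,y,z),\qquad F(x,y,z)=\frac1{1-y}\cdot\frac1{1-z}\bigl(A+A'+A''+A'''\bigr)(x,y,z),\] where \begin{align*} D(x,y,z)&=1-x(1+yz)^2-\frac{xyz}{1-2xy(1+yz)}-\frac{xyz}{1-2xz(1+yz)},\\ A(x,y,z)&=\frac{1-\frac{xy^2z^2}{1-4xyz}\Bigl(1+\frac{2xy}{1-2xy(1+yz)}+\frac{2xz}{1-2xz(1+yz)}\Bigr)}{D(x,y,z)},\\ A'(x,y,z)&=\frac1{1-2xz(1+yz)}\cdot\frac{1-x(1+yz)^2-\frac{xyz}{1-2xy(1+yz)}-xyz}{D(x,y,z)},\\ A''(x,y,z)&=\frac1{1-2xy(1+yz)}\cdot\frac{1-x(1+yz)^2-\frac{xyz}{1-2xz(1+yz)}-xyz}{D(x,y,z)},\\ A'''(x,y,z)&=\frac{1-\frac{x}{1-4xyz}\Bigl(1+\frac{2xy^2z}{1-2xy(1+yz)}+\frac{2xyz^2}{1-2xz(1+yz)}\Bigr)}{D(x,y,z)}, \end{align*} and $[x^ky^\ell z^m]$ denotes coefficient extraction in the formal power series expansion at the origin.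
   Context: For a nonnegative integer $n$, $w(n)$ denotes the number of $1$s in the binary expansion of $n$. For $k\ge0$ and $0\le t<2^k$ write $t^c_k=2^k-1-t$ and define, for $j\in\mathbb Z$, \[\beta_{t,k,j}=\bigl\lvert\{a\in\{0,\ldots,t\}: w(a+t^c_k)-w(a)=j\}\bigr\rvert,\quad \gamma_{t,k,j}=\beta_{t,k,j}+\beta_{t^c_k,k,-j},\quad \Gamma_{t,k,j}=\sum_{i\ge j}\gamma_{t,k,i}.\] Define $M^{(2)}_{k,\ell,m}=\sum_{0\le t<2^k}\Gamma_{t,k,k-\ell}\,\Gamma_{t,k,k-m}$. -}

module Defs where

open import Data.Bool using (Bool; true; false; if_then_else_)
open import Data.Nat as ℕ using (ℕ; zero; suc; _∸_; _^_; _%_; _/_)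
open import Data.Integer as ℤ using (ℤ; +_; -_)
open import Relation.Nullary using (does)

w-fuel : ℕ → ℕ → ℕ
w-fuel zero    n = 0
w-fuel (suc f) n = (n % 2) ℕ.+ w-fuel f (n / 2)

-- w n = number of 1s in the binary expansion of n
-- (n halvings are enough, since n < 2^n).
w : ℕ → ℕ
w n = w-fuel n n

count : (ℕ → Bool) → ℕ → ℕ
count P zero    = if P zero then 1 else 0
count P (suc n) = (if P (suc n) then 1 else 0) ℕ.+ count P n

compl : ℕ → ℕ → ℕ
compl t k = (2 ^ k ∸ 1) ∸ t

δ : ℕ → ℕ → ℤ
δ s a = (+ w (a ℕ.+ s)) ℤ.- (+ w a)

β : ℕ → ℕ → ℤ → ℕ
β t k j = count (λ a → does (δ (compl t k) a ℤ.≟ j)) t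

γ : ℕ → ℕ → ℤ → ℕ
γ t k j = β t k j ℕ.+ β (compl t k) k (- j)

-- Γ_{t,k,j} = Σ_{i ≥ j} γ_{t,k,i}.  Since β_{t,k,i} counts the a ∈ {0..t}
-- whose difference equals i, summing over all i ≥ j counts those with
-- difference ≥ j (and for the second summand, -i ≤ -j).
Γ : ℕ → ℕ → ℤ → ℕ
Γ t k j =
  count (λ a → does (j ℤ.≤? δ (compl t k) a)) t
  ℕ.+ count (λ a → does (δ (compl (compl t k) k) a ℤ.≤? - j)) (compl t k)

sumBelow : ℕ → (ℕ → ℕ) → ℕ
sumBelow zero    f = 0
sumBelow (suc n) f = sumBelow n f ℕ.+ f n

M2 : ℕ → ℕ → ℕ → ℕ
M2 k ℓ m = sumBelow (2 ^ k) (λ t → Γ t k ((+ k) ℤ.- (+ ℓ)) ℕ.* Γ t k ((+ k) ℤ.- (+ m)))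

-- Formal power series in x, y, z over ℤ:  S k l m = [x^k y^l z^m] S

Series : Set
Series = ℕ → ℕ → ℕ → ℤ

sumUpTo : ℕ → (ℕ → ℤ) → ℤ
sumUpTo zero    f = f 0
sumUpTo (suc n) f = sumUpTo n f ℤ.+ f (suc n)

const : ℤ → Series
const c zero zero zero = c
const c _    _    _    = + 0

𝟙 : Series
𝟙 = const (+ 1)

X Y Z : Series
X (suc zero) zero zero = + 1
X _ _ _ = + 0
Y zero (suc zero) zero = + 1
Y _ _ _ = + 0
Z zero zero (suc zero) = + 1
Z _ _ _ = + 0

infixl 6 _⊕_ _⊖_
infixl 7 _⊛_ _⊘_

_⊕_ : Series → Series → Series
(a ⊕ b) k l m = a k l m ℤ.+ b k l m

_⊖_ : Series → Series → Series
(a ⊖ b) k l m = a k l m ℤ.- b k l m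

_⊛_ : Series → Series → Series
(a ⊛ b) k l m =
  sumUpTo k λ i → sumUpTo l λ j → sumUpTo m λ h →
    a i j h ℤ.* b (k ∸ i) (l ∸ j) (m ∸ h)

pow : Series → ℕ → Series
pow a zero    = 𝟙
pow a (suc n) = a ⊛ pow a n

-- Geometric series 1/(1-u) = Σ_j u^j, for u with zero constant term;
-- the coefficient of x^k y^l z^m only receives contributions from j ≤ k+l+m.
geo : Series → Series
geo u k l m = sumUpTo (k ℕ.+ l ℕ.+ m) (λ j → pow u j k l m)

-- Multiplicative inverse of a series with constant term 1:
-- 1/a = 1/(1 - (1 - a)).
inv : Series → Series
inv a = geo (𝟙 ⊖ a)

-- a / b, for b with constant term 1
_⊘_ : Series → Series → Series
a ⊘ b = a ⊛ inv b

c : ℤ → Series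
c = const

P  : Series
P  = 𝟙 ⊕ Y ⊛ Z
Ey : Series
Ey = 𝟙 ⊖ c (+ 2) ⊛ X ⊛ Y ⊛ P
Ez : Series
Ez = 𝟙 ⊖ c (+ 2) ⊛ X ⊛ Z ⊛ P
G  : Series
G  = 𝟙 ⊖ c (+ 4) ⊛ X ⊛ Y ⊛ Z

XYZ : Series
XYZ = X ⊛ Y ⊛ Z

D : Series
D = 𝟙 ⊖ X ⊛ P ⊛ P ⊖ XYZ ⊘ Ey ⊖ XYZ ⊘ Ez

A : Series
A = (𝟙 ⊖ (X ⊛ Y ⊛ Y ⊛ Z ⊛ Z ⊘ G)
          ⊛ (𝟙 ⊕ c (+ 2) ⊛ X ⊛ Y ⊘ Ey ⊕ c (+ 2) ⊛ X ⊛ Z ⊘ Ez)) ⊘ D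

A′ : Series
A′ = (𝟙 ⊘ Ez) ⊛ ((𝟙 ⊖ X ⊛ P ⊛ P ⊖ XYZ ⊘ Ey ⊖ XYZ) ⊘ D)

A″ : Series
A″ = (𝟙 ⊘ Ey) ⊛ ((𝟙 ⊖ X ⊛ P ⊛ P ⊖ XYZ ⊘ Ez ⊖ XYZ) ⊘ D)

A‴ : Series
A‴ = (𝟙 ⊖ (X ⊘ G)
           ⊛ (𝟙 ⊕ c (+ 2) ⊛ X ⊛ Y ⊛ Y ⊛ Z ⊘ Ey ⊕ c (+ 2) ⊛ X ⊛ Y ⊛ Z ⊛ Z ⊘ Ez)) ⊘ D

F : Series
F = (𝟙 ⊘ (𝟙 ⊖ Y)) ⊛ (𝟙 ⊘ (𝟙 ⊖ Z)) ⊛ (A ⊕ A′ ⊕ A″ ⊕ A‴)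

module Submission where

-- Write Γ_{t,k,k-ℓ} as the sum of two counts attached to t: the a ≤ t
-- with w(a + t^c) - w(a) ≥ k - ℓ, and the a ≤ t^c with
-- w(a + t) - w(a) ≤ ℓ - k.  Reading a, t and the sums digit by digit
-- from the lowest binary digit, each count is governed by a carry and
-- a remaining "budget" ℓ, which every digit lowers by 0, 1 or 2.  Hence
-- M^{(2)} is a sum of four families of pair counts (one for each choice
-- of the two kinds of count), and their generating series, indexed by
-- the two carries, satisfy a linear system  S = [no carry]·Σ y^l z^m
-- + x·(y^{cost₁} z^{cost₂} S′ summed over the digits).  Eliminating the
-- carried unknowns from each system gives the four terms A, A′, A″, A‴.

open import Defs
open import Algebra.Bundles using (CommutativeRing)
open import Data.Bool using (Bool; true; false)
open import Data.Nat using (ℕ)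
open import Data.Integer using (+_)
open import Relation.Binary.PropositionalEquality using (_≡_)
import Relation.Binary.PropositionalEquality as ≡

module FiniteSums {c ℓ} (R : CommutativeRing c ℓ) where
  open import Data.Nat as ℕ using (zero; suc; _∸_; _≤_; z≤n)
  import Data.Nat.Properties as ℕP
  open CommutativeRing R
  open import Relation.Binary.Reasoning.Setoid setoid
  open import Algebra.Properties.CommutativeSemigroup +-commutativeSemigroup using (interchange)

  Σ : ℕ → (ℕ → Carrier) → Carrier
  Σ zero    f = f 0
  Σ (suc n) f = Σ n f + f (suc n)

  Σ-cong : ∀ n {f g : ℕ → Carrier} → (∀ i → i ≤ n → f i ≈ g i) → Σ n f ≈ Σ n g
  Σ-cong zero    f≈g = f≈g 0 z≤n
  Σ-cong (suc n) f≈g =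
    +-cong (Σ-cong n (λ i i≤n → f≈g i (ℕP.m≤n⇒m≤1+n i≤n))) (f≈g (suc n) ℕP.≤-refl)

  Σ-+ : ∀ n (f g : ℕ → Carrier) → Σ n (λ i → f i + g i) ≈ Σ n f + Σ n g
  Σ-+ zero    f g = refl
  Σ-+ (suc n) f g = trans (+-cong (Σ-+ n f g) refl) (interchange _ _ _ _)

  Σ-*ˡ : ∀ n x (f : ℕ → Carrier) → x * Σ n f ≈ Σ n (λ i → x * f i)
  Σ-*ˡ zero    x f = refl
  Σ-*ˡ (suc n) x f = trans (distribˡ x _ _) (+-cong (Σ-*ˡ n x f) refl)

  Σ-*ʳ : ∀ n x (f : ℕ → Carrier) → Σ n f * x ≈ Σ n (λ i → f i * x)
  Σ-*ʳ zero    x f = refl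
  Σ-*ʳ (suc n) x f = trans (distribʳ x _ _) (+-cong (Σ-*ʳ n x f) refl)

  Σ-zero : ∀ n (f : ℕ → Carrier) → (∀ i → i ≤ n → f i ≈ 0#) → Σ n f ≈ 0#
  Σ-zero n f f≈0 = trans (Σ-cong n f≈0) (constant-zero n)
    where
    constant-zero : ∀ n → Σ n (λ _ → 0#) ≈ 0#
    constant-zero zero    = refl
    constant-zero (suc n) = trans (+-cong (constant-zero n) refl) (+-identityʳ 0#)

  Σ-head : ∀ n (f : ℕ → Carrier) → Σ (suc n) f ≈ f 0 + Σ n (λ i → f (suc i))
  Σ-head zero    f = refl
  Σ-head (suc n) f = trans (+-cong (Σ-head n f) refl) (+-assoc _ _ _)

  Σ-reverse : ∀ n (f : ℕ → Carrier) → Σ n f ≈ Σ n (λ i → f (n ∸ i))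
  Σ-reverse zero    f = refl
  Σ-reverse (suc n) f = begin
    Σ n f + f (suc n)                          ≈⟨ +-cong (Σ-reverse n f) refl ⟩
    Σ n (λ i → f (n ∸ i)) + f (suc n)          ≈⟨ +-comm _ _ ⟩
    f (suc n) + Σ n (λ i → f (suc n ∸ suc i))  ≈⟨ Σ-head n (λ i → f (suc n ∸ i)) ⟨
    Σ (suc n) (λ i → f (suc n ∸ i))            ∎

  Σ-triangle : ∀ n (g : ℕ → ℕ → Carrier) →
    Σ n (λ i → Σ i (g i)) ≈ Σ n (λ j → Σ (n ∸ j) (λ p → g (j ℕ.+ p) j))
  Σ-triangle zero    g = refl
  Σ-triangle (suc n) g = begin
    Σ n (λ i → Σ i (g i)) + (Σ n (g (suc n)) + g (suc n) (suc n))
      ≈⟨ +-cong (Σ-triangle n g) refl ⟩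
    Σ n column + (Σ n (g (suc n)) + g (suc n) (suc n))
      ≈⟨ +-assoc _ _ _ ⟨
    (Σ n column + Σ n (g (suc n))) + g (suc n) (suc n)
      ≈⟨ +-cong (Σ-+ n _ _) refl ⟨
    Σ n (λ j → column j + g (suc n) j) + g (suc n) (suc n)
      ≈⟨ +-cong (Σ-cong n extend-column) (reflexive (≡.cong (λ q → g q (suc n)) (≡.sym (ℕP.+-identityʳ (suc n))))) ⟩
    Σ n column′ + g (suc n ℕ.+ 0) (suc n)
      ≈⟨ +-cong refl (reflexive (≡.cong (λ q → Σ q (λ p → g (suc n ℕ.+ p) (suc n))) (≡.sym (ℕP.n∸n≡0 n)))) ⟩
    Σ (suc n) column′ ∎
    where
    column column′ : ℕ → Carrier
    column  j = Σ (n ∸ j) (λ p → g (j ℕ.+ p) j)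
    column′ j = Σ (suc n ∸ j) (λ p → g (j ℕ.+ p) j)
    extend-column : ∀ j → j ≤ n → column j + g (suc n) j ≈ column′ j
    extend-column j j≤n rewrite ℕP.+-∸-assoc 1 j≤n =
      +-cong refl (reflexive (≡.cong (λ q → g q j) (≡.sym
        (≡.trans (ℕP.+-suc j (n ∸ j)) (≡.cong suc (ℕP.m+[n∸m]≡n j≤n))))))

module PowerSeries {c ℓ} (R : CommutativeRing c ℓ) where
  import Algebra.Structures as AS
  open import Data.Nat as ℕ using (zero; suc; _∸_; _≤_)
  import Data.Nat.Properties as ℕP
  open import Data.Product using (_,_)
  open CommutativeRing R
  open FiniteSums R
  open import Relation.Binary.Reasoning.Setoid setoid

  PS : Set c
  PS = ℕ → Carrier

  _≈ₚ_ : PS → PS → Set ℓ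
  f ≈ₚ g = ∀ n → f n ≈ g n

  _+ₚ_ _*ₚ_ : PS → PS → PS
  (f +ₚ g) n = f n + g n
  (f *ₚ g) n = Σ n (λ i → f i * g (n ∸ i))

  -ₚ_ : PS → PS
  (-ₚ f) n = - f n

  0ₚ 1ₚ : PS
  0ₚ _       = 0#
  1ₚ zero    = 1#
  1ₚ (suc _) = 0#

  *ₚ-cong : ∀ {f f′ g g′} → f ≈ₚ f′ → g ≈ₚ g′ → (f *ₚ g) ≈ₚ (f′ *ₚ g′)
  *ₚ-cong f≈f′ g≈g′ n = Σ-cong n (λ i _ → *-cong (f≈f′ i) (g≈g′ (n ∸ i)))

  *ₚ-comm : ∀ f g → (f *ₚ g) ≈ₚ (g *ₚ f)
  *ₚ-comm f g n = begin
    Σ n (λ i → f i * g (n ∸ i))               ≈⟨ Σ-reverse n _ ⟩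
    Σ n (λ i → f (n ∸ i) * g (n ∸ (n ∸ i)))   ≈⟨ Σ-cong n swap ⟩
    Σ n (λ i → g i * f (n ∸ i))               ∎
    where
    swap : ∀ i → i ≤ n → f (n ∸ i) * g (n ∸ (n ∸ i)) ≈ g i * f (n ∸ i)
    swap i i≤n = trans (*-comm _ _) (*-cong (reflexive (≡.cong g (ℕP.m∸[m∸n]≡n i≤n))) refl)

  *ₚ-identityˡ : ∀ f → (1ₚ *ₚ f) ≈ₚ f
  *ₚ-identityˡ f zero    = *-identityˡ _
  *ₚ-identityˡ f (suc n) = begin
    Σ (suc n) (λ i → 1ₚ i * f (suc n ∸ i))        ≈⟨ Σ-head n _ ⟩
    1# * f (suc n) + Σ n (λ i → 0# * f (n ∸ i))   ≈⟨ +-cong (*-identityˡ _) (Σ-zero n _ (λ i _ → zeroˡ _)) ⟩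
    f (suc n) + 0#                                ≈⟨ +-identityʳ _ ⟩
    f (suc n)                                     ∎

  *ₚ-distribʳ : ∀ h f g → ((f +ₚ g) *ₚ h) ≈ₚ ((f *ₚ h) +ₚ (g *ₚ h))
  *ₚ-distribʳ h f g n = trans (Σ-cong n (λ i _ → distribʳ _ _ _)) (Σ-+ n _ _)

  *ₚ-assoc : ∀ f g h → ((f *ₚ g) *ₚ h) ≈ₚ (f *ₚ (g *ₚ h))
  *ₚ-assoc f g h n = begin
    Σ n (λ i → Σ i (λ j → f j * g (i ∸ j)) * h (n ∸ i))
      ≈⟨ Σ-cong n (λ i _ → Σ-*ʳ i _ _) ⟩
    Σ n (λ i → Σ i (λ j → f j * g (i ∸ j) * h (n ∸ i)))
      ≈⟨ Σ-triangle n _ ⟩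
    Σ n (λ j → Σ (n ∸ j) (λ p → f j * g (j ℕ.+ p ∸ j) * h (n ∸ (j ℕ.+ p))))
      ≈⟨ Σ-cong n (λ j _ → Σ-cong (n ∸ j) (λ p _ → reindex j p)) ⟩
    Σ n (λ j → Σ (n ∸ j) (λ p → f j * (g p * h (n ∸ j ∸ p))))
      ≈⟨ Σ-cong n (λ j _ → Σ-*ˡ (n ∸ j) _ _) ⟨
    Σ n (λ j → f j * Σ (n ∸ j) (λ p → g p * h (n ∸ j ∸ p))) ∎
    where
    reindex : ∀ j p → f j * g (j ℕ.+ p ∸ j) * h (n ∸ (j ℕ.+ p)) ≈ f j * (g p * h (n ∸ j ∸ p))
    reindex j p = trans (*-assoc _ _ _) (*-cong refl (*-cong
      (reflexive (≡.cong g (ℕP.m+n∸m≡n j p)))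
      (reflexive (≡.cong h (≡.sym (ℕP.∸-+-assoc n j p))))))

  isPowerSeriesRing : AS.IsCommutativeRing _≈ₚ_ _+ₚ_ _*ₚ_ -ₚ_ 0ₚ 1ₚ
  isPowerSeriesRing = record
    { isRing = record
      { +-isAbelianGroup = record
        { isGroup = record
          { isMonoid = record
            { isSemigroup = record
              { isMagma = record
                { isEquivalence = record
                  { refl  = λ n → refl
                  ; sym   = λ p n → sym (p n)
                  ; trans = λ p q n → trans (p n) (q n) }
                ; ∙-cong = λ p q n → +-cong (p n) (q n) }
              ; assoc = λ f g h n → +-assoc _ _ _ }
            ; identity = (λ f n → +-identityˡ _) , (λ f n → +-identityʳ _) }
          ; inverse = (λ f n → -‿inverseˡ _) , (λ f n → -‿inverseʳ _)
          ; ⁻¹-cong = λ p n → -‿cong (p n) }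
        ; comm = λ f g n → +-comm _ _ }
      ; *-cong     = *ₚ-cong
      ; *-assoc    = *ₚ-assoc
      ; *-identity = *ₚ-identityˡ , (λ f n → trans (*ₚ-comm f 1ₚ n) (*ₚ-identityˡ f n))
      ; distrib    = (λ h f g n → trans (*ₚ-comm h (f +ₚ g) n)
                                    (trans (*ₚ-distribʳ h f g n) (+-cong (*ₚ-comm f h n) (*ₚ-comm g h n))))
                   , *ₚ-distribʳ }
    ; *-comm = *ₚ-comm }

  powerSeriesRing : CommutativeRing c ℓ
  powerSeriesRing = record { isCommutativeRing = isPowerSeriesRing }

module IntegerSums where
  open import Data.Nat as ℕ using (zero; suc; _∸_; _≤_; _<_; z≤n; s≤s)
  import Data.Nat.Properties as ℕP
  open import Data.Integer as ℤ using (ℤ)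
  import Data.Integer.Properties as ℤP
  open import Relation.Binary.PropositionalEquality using (refl; sym; cong₂)
  open import Algebra.Properties.CommutativeSemigroup ℤP.+-commutativeSemigroup
    using (interchange)

  sumUpTo-cong : ∀ n {f g : ℕ → ℤ} → (∀ i → i ≤ n → f i ≡ g i) → sumUpTo n f ≡ sumUpTo n g
  sumUpTo-cong zero    f≡g = f≡g 0 z≤n
  sumUpTo-cong (suc n) f≡g =
    cong₂ ℤ._+_ (sumUpTo-cong n (λ i i≤n → f≡g i (ℕP.m≤n⇒m≤1+n i≤n))) (f≡g (suc n) ℕP.≤-refl)

  sumUpTo-zero : ∀ n (f : ℕ → ℤ) → (∀ i → i ≤ n → f i ≡ + 0) → sumUpTo n f ≡ + 0
  sumUpTo-zero zero    f f≡0 = f≡0 0 z≤n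
  sumUpTo-zero (suc n) f f≡0
    rewrite sumUpTo-zero n f (λ i i≤n → f≡0 i (ℕP.m≤n⇒m≤1+n i≤n)) | f≡0 (suc n) ℕP.≤-refl = refl

  sumUpTo-head : ∀ n (f : ℕ → ℤ) → sumUpTo (suc n) f ≡ f 0 ℤ.+ sumUpTo n (λ i → f (suc i))
  sumUpTo-head zero    f = refl
  sumUpTo-head (suc n) f rewrite sumUpTo-head n f = ℤP.+-assoc (f 0) _ _

  sumUpTo-only-0 : ∀ n (f : ℕ → ℤ) → (∀ i → f (suc i) ≡ + 0) → sumUpTo n f ≡ f 0
  sumUpTo-only-0 zero    f _    = refl
  sumUpTo-only-0 (suc n) f tail
    rewrite sumUpTo-head n f | sumUpTo-zero n (λ i → f (suc i)) (λ i _ → tail i) = ℤP.+-identityʳ (f 0)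

  sumUpTo-only-1 : ∀ n (f : ℕ → ℤ) → f 0 ≡ + 0 → (∀ i → f (suc (suc i)) ≡ + 0) → sumUpTo (suc n) f ≡ f 1
  sumUpTo-only-1 n f f0 tail
    rewrite sumUpTo-head n f | f0 | sumUpTo-only-0 n (λ i → f (suc i)) tail = ℤP.+-identityˡ (f 1)

  sumUpTo-+ : ∀ n (f g : ℕ → ℤ) → sumUpTo n (λ i → f i ℤ.+ g i) ≡ sumUpTo n f ℤ.+ sumUpTo n g
  sumUpTo-+ zero    f g = refl
  sumUpTo-+ (suc n) f g rewrite sumUpTo-+ n f g = interchange (sumUpTo n f) (sumUpTo n g) (f (suc n)) (g (suc n))

  sumUpTo-*ˡ : ∀ n x (f : ℕ → ℤ) → x ℤ.* sumUpTo n f ≡ sumUpTo n (λ i → x ℤ.* f i)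
  sumUpTo-*ˡ zero    x f = refl
  sumUpTo-*ˡ (suc n) x f rewrite sym (sumUpTo-*ˡ n x f) = ℤP.*-distribˡ-+ x _ _

  sumUpTo-swap : ∀ n k (g : ℕ → ℕ → ℤ) →
    sumUpTo n (λ p → sumUpTo k (g p)) ≡ sumUpTo k (λ i → sumUpTo n (λ p → g p i))
  sumUpTo-swap zero    k g = refl
  sumUpTo-swap (suc n) k g rewrite sumUpTo-swap n k g = sym (sumUpTo-+ k _ _)

  sumUpTo-extend : ∀ {M n} (f : ℕ → ℤ) → M ≤ n → (∀ p → M < p → f p ≡ + 0) → sumUpTo n f ≡ sumUpTo M f
  sumUpTo-extend {M} {n} f M≤n vanish
    rewrite sym (ℕP.m∸n+n≡m M≤n) = add-vanishing (n ∸ M)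
    where
    add-vanishing : ∀ d → sumUpTo (d ℕ.+ M) f ≡ sumUpTo M f
    add-vanishing zero    = refl
    add-vanishing (suc d) rewrite add-vanishing d | vanish (suc (d ℕ.+ M)) (s≤s (ℕP.m≤n+m M d)) = ℤP.+-identityʳ _

-- The trivariate series of Defs form a commutative ring: they are power
-- series in x whose coefficients are power series in y whose
-- coefficients are power series in z, and the Cauchy product _⊛_ agrees
-- with the product of that iterated power series ring.
module SeriesRing where
  import Algebra.Structures as AS
  open import Data.Nat as ℕ using (zero; suc)
  open import Data.Integer as ℤ using (ℤ)
  import Data.Integer.Properties as ℤP
  open import Data.Product using (_,_)
  open import Relation.Binary.PropositionalEquality using (refl; sym; trans; cong; cong₂)
  open IntegerSums

  ℤ-ring : CommutativeRing _ _
  ℤ-ring = ℤP.+-*-commutativeRing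

  ring-z ring-yz ring-xyz : CommutativeRing _ _
  ring-z   = PowerSeries.powerSeriesRing ℤ-ring
  ring-yz  = PowerSeries.powerSeriesRing ring-z
  ring-xyz = PowerSeries.powerSeriesRing ring-yz

  private
    module Rxyz = CommutativeRing ring-xyz
    module Σz   = FiniteSums ℤ-ring
    module Σyz  = FiniteSums ring-z
    module Σxyz = FiniteSums ring-yz

  infix 4 _≈_
  _≈_ : Series → Series → Set
  a ≈ b = ∀ k l m → a k l m ≡ b k l m

  Σz-sumUpTo : ∀ n f → Σz.Σ n f ≡ sumUpTo n f
  Σz-sumUpTo zero    f = refl
  Σz-sumUpTo (suc n) f = cong (ℤ._+ f (suc n)) (Σz-sumUpTo n f)

  Σyz-sumUpTo : ∀ n (f : ℕ → ℕ → ℤ) m → Σyz.Σ n f m ≡ sumUpTo n (λ j → f j m)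
  Σyz-sumUpTo zero    f m = refl
  Σyz-sumUpTo (suc n) f m = cong (ℤ._+ f (suc n) m) (Σyz-sumUpTo n f m)

  Σxyz-sumUpTo : ∀ n (f : ℕ → ℕ → ℕ → ℤ) l m → Σxyz.Σ n f l m ≡ sumUpTo n (λ i → f i l m)
  Σxyz-sumUpTo zero    f l m = refl
  Σxyz-sumUpTo (suc n) f l m = cong (ℤ._+ f (suc n) l m) (Σxyz-sumUpTo n f l m)

  ⊛-is-product : ∀ a b → (a ⊛ b) ≈ a Rxyz.* b
  ⊛-is-product a b k l m = sym (trans (Σxyz-sumUpTo k _ l m) (sumUpTo-cong k (λ i _ →
    trans (Σyz-sumUpTo l _ m) (sumUpTo-cong l (λ j _ → Σz-sumUpTo m _)))))

  𝟙-is-one : 𝟙 ≈ Rxyz.1#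
  𝟙-is-one zero    zero    zero    = refl
  𝟙-is-one zero    zero    (suc m) = refl
  𝟙-is-one zero    (suc l) m       = refl
  𝟙-is-one (suc k) l       m       = refl

  neg : Series → Series
  neg a k l m = ℤ.- a k l m

  𝟘 : Series
  𝟘 _ _ _ = + 0

  private
    ≈-trans : ∀ {a b c} → a ≈ b → b ≈ c → a ≈ c
    ≈-trans p q k l m = trans (p k l m) (q k l m)
    ≈-sym : ∀ {a b} → a ≈ b → b ≈ a
    ≈-sym p k l m = sym (p k l m)

    via-product : ∀ {a b c d} → (a Rxyz.* b) ≈ (c Rxyz.* d) → (a ⊛ b) ≈ (c ⊛ d)
    via-product {a} {b} {c} {d} p = ≈-trans (⊛-is-product a b) (≈-trans p (≈-sym (⊛-is-product c d)))

  isSeriesRing : AS.IsCommutativeRing _≈_ _⊕_ _⊛_ neg 𝟘 𝟙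
  isSeriesRing = record
    { isRing = record
      { +-isAbelianGroup = Rxyz.+-isAbelianGroup
      ; *-cong     = λ {a} {a′} {b} {b′} p q → via-product {a} {b} {a′} {b′} (Rxyz.*-cong p q)
      ; *-assoc    = λ a b c → ≈-trans (⊛-is-product (a ⊛ b) c)
                       (≈-trans (Rxyz.*-cong (⊛-is-product a b) (Rxyz.refl {c}))
                       (≈-trans (Rxyz.*-assoc a b c)
                       (≈-trans (Rxyz.*-cong (Rxyz.refl {a}) (≈-sym (⊛-is-product b c)))
                       (≈-sym (⊛-is-product a (b ⊛ c))))))
      ; *-identity = (λ a → ≈-trans (⊛-is-product 𝟙 a) (≈-trans (Rxyz.*-cong 𝟙-is-one (Rxyz.refl {a})) (Rxyz.*-identityˡ a)))
                   , (λ a → ≈-trans (⊛-is-product a 𝟙) (≈-trans (Rxyz.*-cong (Rxyz.refl {a}) 𝟙-is-one) (Rxyz.*-identityʳ a)))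
      ; distrib    = (λ a b c → ≈-trans (⊛-is-product a (b ⊕ c)) (≈-trans (Rxyz.distribˡ a b c)
                        (λ k l m → sym (cong₂ ℤ._+_ (⊛-is-product a b k l m) (⊛-is-product a c k l m)))))
                   , (λ a b c → ≈-trans (⊛-is-product (b ⊕ c) a) (≈-trans (Rxyz.distribʳ a b c)
                        (λ k l m → sym (cong₂ ℤ._+_ (⊛-is-product b a k l m) (⊛-is-product c a k l m)))))
      }
    ; *-comm = λ a b → via-product {a} {b} {b} {a} (Rxyz.*-comm a b)
    }

  seriesRing : CommutativeRing _ _
  seriesRing = record { isCommutativeRing = isSeriesRing }

module Constants where
  open import Algebra.Solver.Ring.AlmostCommutativeRing using (fromCommutativeRing; _-Raw-AlmostCommutative⟶_)
  open import Data.Nat as ℕ using (zero; suc)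
  open import Data.Integer as ℤ using (ℤ)
  import Data.Integer.Properties as ℤP
  open import Data.Maybe using (Maybe; just; nothing)
  open import Relation.Nullary using (yes; no)
  open import Relation.Binary.PropositionalEquality using (refl; sym; trans)
  open IntegerSums
  open SeriesRing

  const-⊛ : ∀ a s k l m → (const a ⊛ s) k l m ≡ a ℤ.* s k l m
  const-⊛ a s k l m =
    trans (sumUpTo-only-0 k _ (λ i → sumUpTo-zero l _ (λ j _ → sumUpTo-zero m _ (λ h _ → refl))))
    (trans (sumUpTo-only-0 l _ (λ j → sumUpTo-zero m _ (λ h _ → refl)))
           (sumUpTo-only-0 m _ (λ h → refl)))

  -- const is a ring morphism ℤ → Series, so ℤ serves as coefficient ring
  -- of the ring solver for series.
  const-morphism : ℤ.+-*-rawRing -Raw-AlmostCommutative⟶ fromCommutativeRing seriesRing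
  const-morphism = record
    { ⟦_⟧    = const
    ; +-homo = +-homo
    ; *-homo = λ a b k l m → sym (trans (const-⊛ a (const b) k l m) (*-homo a b k l m))
    ; -‿homo = -‿homo
    ; 0-homo = 0-homo
    ; 1-homo = λ k l m → refl
    }
    where
    +-homo : ∀ a b → const (a ℤ.+ b) ≈ (const a ⊕ const b)
    +-homo a b zero    zero    zero    = refl
    +-homo a b zero    zero    (suc m) = refl
    +-homo a b zero    (suc l) m       = refl
    +-homo a b (suc k) l       m       = refl
    *-homo : ∀ a b k l m → a ℤ.* const b k l m ≡ const (a ℤ.* b) k l m
    *-homo a b zero    zero    zero    = refl
    *-homo a b zero    zero    (suc m) = ℤP.*-zeroʳ a
    *-homo a b zero    (suc l) m       = ℤP.*-zeroʳ a
    *-homo a b (suc k) l       m       = ℤP.*-zeroʳ a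
    -‿homo : ∀ a → const (ℤ.- a) ≈ neg (const a)
    -‿homo a zero    zero    zero    = refl
    -‿homo a zero    zero    (suc m) = refl
    -‿homo a zero    (suc l) m       = refl
    -‿homo a (suc k) l       m       = refl
    0-homo : const (+ 0) ≈ 𝟘
    0-homo zero    zero    zero    = refl
    0-homo zero    zero    (suc m) = refl
    0-homo zero    (suc l) m       = refl
    0-homo (suc k) l       m       = refl

  const-≟ : ∀ a b → Maybe (const a ≈ const b)
  const-≟ a b with a ℤ.≟ b
  ... | yes refl = just (λ k l m → refl)
  ... | no _     = nothing

module SeriesSolver where
  import Algebra.Solver.Ring
  open import Algebra.Solver.Ring.AlmostCommutativeRing using (fromCommutativeRing)
  open import Data.Integer using (+-*-rawRing)

  open Algebra.Solver.Ring +-*-rawRing (fromCommutativeRing SeriesRing.seriesRing)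
    Constants.const-morphism Constants.const-≟ public

-- The key fact is that the geometric
-- series g = Σ_j u^j of a series u without constant term satisfies
-- g = 1 + u g; since u^j only has monomials of total degree ≥ j, the
-- truncation of that infinite sum used by 'geo' is harmless.
module GeometricSeries where
  open import Data.Nat as ℕ using (zero; suc; _∸_; _≤_; _<_; z≤n; s≤s)
  import Data.Nat.Properties as ℕP
  open import Data.Integer as ℤ using (ℤ)
  import Data.Integer.Properties as ℤP
  open import Relation.Binary.PropositionalEquality using (refl; sym; trans; cong; cong₂; subst; module ≡-Reasoning)
  import Data.Nat.Tactic.RingSolver as ℕSolver
  open IntegerSums
  open SeriesRing
  open ≡-Reasoning

  degree-split : ∀ {i j h k l m} → i ≤ k → j ≤ l → h ≤ m →
    ((k ∸ i) ℕ.+ (l ∸ j) ℕ.+ (m ∸ h)) ℕ.+ (i ℕ.+ j ℕ.+ h) ≡ k ℕ.+ l ℕ.+ m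
  degree-split {i} {j} {h} {k} {l} {m} i≤k j≤l h≤m = begin
    ((k ∸ i) ℕ.+ (l ∸ j) ℕ.+ (m ∸ h)) ℕ.+ (i ℕ.+ j ℕ.+ h)
      ≡⟨ regroup (k ∸ i) (l ∸ j) (m ∸ h) i j h ⟩
    ((k ∸ i) ℕ.+ i) ℕ.+ ((l ∸ j) ℕ.+ j) ℕ.+ ((m ∸ h) ℕ.+ h)
      ≡⟨ cong₂ ℕ._+_ (cong₂ ℕ._+_ (ℕP.m∸n+n≡m i≤k) (ℕP.m∸n+n≡m j≤l)) (ℕP.m∸n+n≡m h≤m) ⟩
    k ℕ.+ l ℕ.+ m ∎
    where
    regroup : ∀ a b c i j h → (a ℕ.+ b ℕ.+ c) ℕ.+ (i ℕ.+ j ℕ.+ h) ≡ (a ℕ.+ i) ℕ.+ (b ℕ.+ j) ℕ.+ (c ℕ.+ h)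
    regroup = ℕSolver.solve-∀

  cofactor-degree-≤ : ∀ {i j h k l m} → i ≤ k → j ≤ l → h ≤ m →
    (k ∸ i) ℕ.+ (l ∸ j) ℕ.+ (m ∸ h) ≤ k ℕ.+ l ℕ.+ m
  cofactor-degree-≤ {i} {j} {h} {k} {l} {m} i≤k j≤l h≤m =
    subst ((k ∸ i) ℕ.+ (l ∸ j) ℕ.+ (m ∸ h) ≤_) (degree-split i≤k j≤l h≤m) (ℕP.m≤m+n _ (i ℕ.+ j ℕ.+ h))

  lowers-degree : ∀ {i j h k l m} → i ≤ k → j ≤ l → h ≤ m → 0 < i ℕ.+ j ℕ.+ h →
    (k ∸ i) ℕ.+ (l ∸ j) ℕ.+ (m ∸ h) < k ℕ.+ l ℕ.+ m
  lowers-degree {i} {j} {h} {k} {l} {m} i≤k j≤l h≤m pos =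
    subst ((k ∸ i) ℕ.+ (l ∸ j) ℕ.+ (m ∸ h) <_) (degree-split i≤k j≤l h≤m) (ℕP.m<m+n _ pos)

  module _ (u : Series) (u₀ : u 0 0 0 ≡ + 0) where

    pow-vanishes : ∀ p k l m → k ℕ.+ l ℕ.+ m < p → pow u p k l m ≡ + 0
    pow-vanishes (suc p) k l m (s≤s d≤p) =
      sumUpTo-zero k _ λ i i≤k → sumUpTo-zero l _ λ j j≤l → sumUpTo-zero m _ λ h h≤m →
        term i j h i≤k j≤l h≤m
      where
      cofactor : ∀ {i j h} → i ≤ k → j ≤ l → h ≤ m → 0 < i ℕ.+ j ℕ.+ h →
                 pow u p (k ∸ i) (l ∸ j) (m ∸ h) ≡ + 0
      cofactor i≤k j≤l h≤m pos =
        pow-vanishes p _ _ _ (ℕP.<-≤-trans (lowers-degree i≤k j≤l h≤m pos) d≤p)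
      term : ∀ i j h → i ≤ k → j ≤ l → h ≤ m → u i j h ℤ.* pow u p (k ∸ i) (l ∸ j) (m ∸ h) ≡ + 0
      term zero    zero    zero    _   _   _   rewrite u₀ = refl
      term (suc i) j       h       i≤k j≤l h≤m
        rewrite cofactor {suc i} {j} {h} i≤k j≤l h≤m (s≤s z≤n) = ℤP.*-zeroʳ (u (suc i) j h)
      term zero    (suc j) h       i≤k j≤l h≤m
        rewrite cofactor {0} {suc j} {h} i≤k j≤l h≤m (s≤s z≤n) = ℤP.*-zeroʳ (u 0 (suc j) h)
      term zero    zero    (suc h) i≤k j≤l h≤m
        rewrite cofactor {0} {0} {suc h} i≤k j≤l h≤m (s≤s z≤n) = ℤP.*-zeroʳ (u 0 0 (suc h))

    geo-truncation : ∀ {N} k l m → k ℕ.+ l ℕ.+ m ≤ N →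
      sumUpTo N (λ p → pow u p k l m) ≡ geo u k l m
    geo-truncation k l m d≤N = sumUpTo-extend _ d≤N (λ p d<p → pow-vanishes p k l m d<p)

    geo-fixpoint : geo u ≈ 𝟙 ⊕ u ⊛ geo u
    geo-fixpoint k l m = begin
      geo u k l m
        ≡⟨ geo-truncation k l m (ℕP.n≤1+n d) ⟨
      sumUpTo (suc d) (λ p → pow u p k l m)
        ≡⟨ sumUpTo-head d _ ⟩
      𝟙 k l m ℤ.+ sumUpTo d (λ p → (u ⊛ pow u p) k l m)
        ≡⟨ cong (λ s → 𝟙 k l m ℤ.+ s) product-of-sum ⟩
      (𝟙 ⊕ u ⊛ geo u) k l m ∎
      where
      d = k ℕ.+ l ℕ.+ m
      product-of-sum : sumUpTo d (λ p → (u ⊛ pow u p) k l m) ≡ (u ⊛ geo u) k l m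
      product-of-sum = begin
        sumUpTo d (λ p → sumUpTo k λ i → sumUpTo l λ j → sumUpTo m λ h → term p i j h)
          ≡⟨ sumUpTo-swap d k _ ⟩
        sumUpTo k (λ i → sumUpTo d λ p → sumUpTo l λ j → sumUpTo m λ h → term p i j h)
          ≡⟨ sumUpTo-cong k (λ i _ → sumUpTo-swap d l _) ⟩
        sumUpTo k (λ i → sumUpTo l λ j → sumUpTo d λ p → sumUpTo m λ h → term p i j h)
          ≡⟨ sumUpTo-cong k (λ i _ → sumUpTo-cong l (λ j _ → sumUpTo-swap d m _)) ⟩
        sumUpTo k (λ i → sumUpTo l λ j → sumUpTo m λ h → sumUpTo d λ p → term p i j h)
          ≡⟨ sumUpTo-cong k (λ i i≤k → sumUpTo-cong l (λ j j≤l → sumUpTo-cong m (λ h h≤m →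
               trans (sym (sumUpTo-*ˡ d (u i j h) _))
                     (cong (u i j h ℤ.*_) (geo-truncation _ _ _ (cofactor-degree-≤ i≤k j≤l h≤m)))))) ⟩
        (u ⊛ geo u) k l m ∎
        where
        term : ℕ → ℕ → ℕ → ℕ → ℤ
        term p i j h = u i j h ℤ.* pow u p (k ∸ i) (l ∸ j) (m ∸ h)

module Inverses where
  import Data.Integer.Properties as ℤP
  open import Relation.Binary.PropositionalEquality using (refl; sym)
  open SeriesRing
  open SeriesSolver using (solve; _:=_; _:+_; _:-_; _:*_; con)
  open CommutativeRing seriesRing
    using (setoid; +-cong; *-cong; -‿inverseʳ; +-identityʳ; zeroˡ)
    renaming (refl to ≈-refl)
  open import Relation.Binary.Reasoning.Setoid setoid

  difference-zero : ∀ {a b} → a ≈ b → (a ⊖ b) ≈ 𝟘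
  difference-zero {a} {b} a≈b k l m rewrite a≈b k l m = ℤP.+-inverseʳ (b k l m)

  inv-law : ∀ a → a 0 0 0 ≡ + 1 → (a ⊛ inv a) ≈ 𝟙
  inv-law a a₀ = begin
    a ⊛ inv a
      ≈⟨ solve 2 (λ a g → a :* g := con (+ 1) :+ (g :- (con (+ 1) :+ (con (+ 1) :- a) :* g))) ≈-refl a (inv a) ⟩
    𝟙 ⊕ (inv a ⊖ (𝟙 ⊕ (𝟙 ⊖ a) ⊛ inv a))
      ≈⟨ +-cong (≈-refl {𝟙}) (difference-zero (GeometricSeries.geo-fixpoint (𝟙 ⊖ a) u₀)) ⟩
    𝟙 ⊕ 𝟘
      ≈⟨ +-identityʳ 𝟙 ⟩
    𝟙 ∎
    where
    u₀ : (𝟙 ⊖ a) 0 0 0 ≡ + 0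
    u₀ rewrite a₀ = refl

  divide : ∀ a {x y} → a 0 0 0 ≡ + 1 → (a ⊛ x) ≈ y → x ≈ (inv a ⊛ y)
  divide a {x} {y} a₀ ax≈y = begin
    x
      ≈⟨ solve 3 (λ a i x → x := i :* (a :* x) :+ (con (+ 1) :- a :* i) :* x) ≈-refl a (inv a) x ⟩
    inv a ⊛ (a ⊛ x) ⊕ (𝟙 ⊖ a ⊛ inv a) ⊛ x
      ≈⟨ +-cong (*-cong (≈-refl {inv a}) ax≈y) (*-cong (difference-zero (λ k l m → sym (inv-law a a₀ k l m))) (≈-refl {x})) ⟩
    inv a ⊛ y ⊕ 𝟘 ⊛ x
      ≈⟨ +-cong (≈-refl {inv a ⊛ y}) (zeroˡ x) ⟩
    inv a ⊛ y ⊕ 𝟘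
      ≈⟨ +-identityʳ _ ⟩
    inv a ⊛ y ∎

module BinaryDigits where
  open import Data.Nat as ℕ using (zero; suc; _≤_; z≤n; s≤s; _%_; _/_)
  import Data.Nat.Properties as ℕP
  open import Data.Nat.DivMod using ([m+kn]%n≡m%n; +-distrib-/-∣ʳ; m*n/n≡m; m/n<m)
  open import Data.Nat.Divisibility using (n∣m*n)
  open import Relation.Binary.PropositionalEquality using (refl; cong; cong₂; module ≡-Reasoning)
  open ≡-Reasoning

  bit : Bool → ℕ
  bit false = 0
  bit true  = 1

  digit : Bool → ℕ → ℕ
  digit o q = bit o ℕ.+ 2 ℕ.* q

  digit-mod-2 : ∀ o q → digit o q % 2 ≡ bit o
  digit-mod-2 o q = begin
    (bit o ℕ.+ 2 ℕ.* q) % 2   ≡⟨ cong (λ n → (bit o ℕ.+ n) % 2) (ℕP.*-comm 2 q) ⟩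
    (bit o ℕ.+ q ℕ.* 2) % 2   ≡⟨ [m+kn]%n≡m%n (bit o) q 2 ⟩
    bit o % 2                 ≡⟨ small o ⟩
    bit o                     ∎
    where
    small : ∀ o → bit o % 2 ≡ bit o
    small false = refl
    small true  = refl

  digit-div-2 : ∀ o q → digit o q / 2 ≡ q
  digit-div-2 o q = begin
    (bit o ℕ.+ 2 ℕ.* q) / 2     ≡⟨ cong (λ n → (bit o ℕ.+ n) / 2) (ℕP.*-comm 2 q) ⟩
    (bit o ℕ.+ q ℕ.* 2) / 2     ≡⟨ +-distrib-/-∣ʳ (bit o) (n∣m*n q) ⟩
    bit o / 2 ℕ.+ q ℕ.* 2 / 2   ≡⟨ cong₂ ℕ._+_ (small o) (m*n/n≡m q 2) ⟩
    q                           ∎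
    where
    small : ∀ o → bit o / 2 ≡ 0
    small false = refl
    small true  = refl

  half-≤ : ∀ {n f} → n ≤ suc f → n / 2 ≤ f
  half-≤ {zero}  _     = z≤n
  half-≤ {suc n} n≤1+f = ℕP.≤-pred (ℕP.<-≤-trans (m/n<m (suc n) 2 (s≤s (s≤s z≤n))) n≤1+f)

  w-fuel-stable : ∀ f g n → n ≤ f → n ≤ g → w-fuel f n ≡ w-fuel g n
  w-fuel-stable zero    zero    n  _   _   = refl
  w-fuel-stable zero    (suc g) .0 z≤n _   = w-fuel-stable zero g 0 z≤n z≤n
  w-fuel-stable (suc f) zero    .0 _   z≤n = w-fuel-stable f zero 0 z≤n z≤n
  w-fuel-stable (suc f) (suc g) n  n≤f n≤g =
    cong (n % 2 ℕ.+_) (w-fuel-stable f g (n / 2) (half-≤ n≤f) (half-≤ n≤g))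

  w-unfold : ∀ n → w n ≡ n % 2 ℕ.+ w (n / 2)
  w-unfold zero    = refl
  w-unfold (suc n) =
    cong (suc n % 2 ℕ.+_) (w-fuel-stable n (suc n / 2) (suc n / 2) (half-≤ ℕP.≤-refl) ℕP.≤-refl)

  w-digit : ∀ o q → w (digit o q) ≡ bit o ℕ.+ w q
  w-digit o q = begin
    w (digit o q)                              ≡⟨ w-unfold (digit o q) ⟩
    digit o q % 2 ℕ.+ w (digit o q / 2)        ≡⟨ cong₂ (λ a b → a ℕ.+ w b) (digit-mod-2 o q) (digit-div-2 o q) ⟩
    bit o ℕ.+ w q                              ∎

module NaturalSums where
  open import Data.Bool using (if_then_else_; _∧_)
  open import Data.Nat as ℕ using (zero; suc; _∸_; _≤_; _<_; _<?_)
  import Data.Nat.Properties as ℕP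
  open import Relation.Nullary using (does)
  open import Relation.Nullary.Decidable using (dec-true; dec-false)
  open import Relation.Binary.PropositionalEquality using (refl; sym; trans; cong; cong₂; module ≡-Reasoning)
  import Data.Nat.Tactic.RingSolver as ℕSolver
  open ≡-Reasoning
  open BinaryDigits
  open import Algebra.Properties.CommutativeSemigroup ℕP.+-commutativeSemigroup
    using (interchange)

  Σ₂ : (Bool → ℕ) → ℕ
  Σ₂ f = f false ℕ.+ f true

  sumBelow-cong : ∀ n {f g : ℕ → ℕ} → (∀ t → t < n → f t ≡ g t) → sumBelow n f ≡ sumBelow n g
  sumBelow-cong zero    f≡g = refl
  sumBelow-cong (suc n) f≡g =
    cong₂ ℕ._+_ (sumBelow-cong n (λ t t<n → f≡g t (ℕP.m<n⇒m<1+n t<n))) (f≡g n ℕP.≤-refl)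

  sumBelow-+ : ∀ n (f g : ℕ → ℕ) → sumBelow n (λ t → f t ℕ.+ g t) ≡ sumBelow n f ℕ.+ sumBelow n g
  sumBelow-+ zero    f g = refl
  sumBelow-+ (suc n) f g rewrite sumBelow-+ n f g = interchange (sumBelow n f) (sumBelow n g) (f n) (g n)

  sumBelow-Σ₂ : ∀ n (f : ℕ → Bool → ℕ) → sumBelow n (λ t → Σ₂ (f t)) ≡ Σ₂ (λ b → sumBelow n (λ t → f t b))
  sumBelow-Σ₂ n f = sumBelow-+ n (λ t → f t false) (λ t → f t true)

  sumBelow-Σ₂² : ∀ n (f : ℕ → Bool → Bool → ℕ) →
    sumBelow n (λ t → Σ₂ λ a → Σ₂ λ b → f t a b) ≡ Σ₂ (λ a → Σ₂ λ b → sumBelow n (λ t → f t a b))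
  sumBelow-Σ₂² n f = trans (sumBelow-Σ₂ n (λ t a → Σ₂ (f t a)))
    (cong₂ ℕ._+_ (sumBelow-Σ₂ n (λ t → f t false)) (sumBelow-Σ₂ n (λ t → f t true)))

  sumBelow-Σ₂³ : ∀ n (f : ℕ → Bool → Bool → Bool → ℕ) →
    sumBelow n (λ t → Σ₂ λ a → Σ₂ λ b → Σ₂ λ c → f t a b c) ≡
    Σ₂ (λ a → Σ₂ λ b → Σ₂ λ c → sumBelow n (λ t → f t a b c))
  sumBelow-Σ₂³ n f = trans (sumBelow-Σ₂ n (λ t a → Σ₂ λ b → Σ₂ (f t a b)))
    (cong₂ ℕ._+_ (sumBelow-Σ₂² n (λ t → f t false)) (sumBelow-Σ₂² n (λ t → f t true)))

  -- A number below 2n is a binary digit followed by a number below n.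
  sumBelow-double : ∀ n (f : ℕ → ℕ) → sumBelow (2 ℕ.* n) f ≡ sumBelow n (λ t → Σ₂ (λ b → f (digit b t)))
  sumBelow-double zero    f = refl
  sumBelow-double (suc n) f = begin
    sumBelow (2 ℕ.* suc n) f                ≡⟨ cong (λ x → sumBelow x f) (ℕP.*-suc 2 n) ⟩
    sumBelow 2n f ℕ.+ f 2n ℕ.+ f (suc 2n)   ≡⟨ ℕP.+-assoc (sumBelow 2n f) _ _ ⟩
    sumBelow 2n f ℕ.+ (f 2n ℕ.+ f (suc 2n)) ≡⟨ cong (ℕ._+ (f 2n ℕ.+ f (suc 2n))) (sumBelow-double n f) ⟩
    sumBelow (suc n) (λ t → Σ₂ (λ b → f (digit b t))) ∎
    where 2n = 2 ℕ.* n

  Σ₂-product : ∀ (f g : Bool → ℕ) → Σ₂ f ℕ.* Σ₂ g ≡ Σ₂ (λ α → Σ₂ (λ β → f α ℕ.* g β))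
  Σ₂-product f g = expand (f false) (f true) (g false) (g true)
    where
    expand : ∀ a b c d → (a ℕ.+ b) ℕ.* (c ℕ.+ d) ≡ (a ℕ.* c ℕ.+ a ℕ.* d) ℕ.+ (b ℕ.* c ℕ.+ b ℕ.* d)
    expand = ℕSolver.solve-∀

  Σ₂-zero : ∀ {f : Bool → ℕ} → (∀ b → f b ≡ 0) → Σ₂ f ≡ 0
  Σ₂-zero f≡0 rewrite f≡0 false | f≡0 true = refl

  indicator : Bool → ℕ
  indicator b = if b then 1 else 0

  sumBelow-extend : ∀ {n N} (f : ℕ → ℕ) → n ≤ N → (∀ a → n ≤ a → f a ≡ 0) → sumBelow N f ≡ sumBelow n f
  sumBelow-extend {n} {N} f n≤N vanish rewrite sym (ℕP.m∸n+n≡m n≤N) = add-vanishing (N ∸ n)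
    where
    add-vanishing : ∀ d → sumBelow (d ℕ.+ n) f ≡ sumBelow n f
    add-vanishing zero    = refl
    add-vanishing (suc d) rewrite add-vanishing d | vanish (d ℕ.+ n) (ℕP.m≤n+m n d) = ℕP.+-identityʳ _

  count-as-sumBelow : ∀ (P : ℕ → Bool) {t N} → t < N →
    count P t ≡ sumBelow N (λ a → indicator (does (a <? suc t) ∧ P a))
  count-as-sumBelow P {t} {N} t<N = begin
    count P t                                 ≡⟨ count-sumBelow t ⟩
    sumBelow (suc t) (λ a → indicator (P a))
      ≡⟨ sumBelow-cong (suc t) (λ a a≤t → cong (restrict a) (dec-true (a <? suc t) a≤t)) ⟨
    sumBelow (suc t) restricted
      ≡⟨ sumBelow-extend restricted t<N (λ a t<a → cong (restrict a) (dec-false (a <? suc t) (ℕP.≤⇒≯ t<a))) ⟨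
    sumBelow N restricted                     ∎
    where
    restrict : ℕ → Bool → ℕ
    restrict a inside = indicator (inside ∧ P a)
    restricted : ℕ → ℕ
    restricted a = restrict a (does (a <? suc t))
    count-sumBelow : ∀ t → count P t ≡ sumBelow (suc t) (λ a → indicator (P a))
    count-sumBelow zero    = refl
    count-sumBelow (suc t) rewrite count-sumBelow t = ℕP.+-comm (indicator (P (suc t))) _

module FullAdder where
  open import Data.Bool using (_∧_; _xor_; _∨_)
  open import Data.Nat as ℕ using (suc; z≤n; s≤s; _≤_; _<_; _<?_)
  import Data.Nat.Properties as ℕP
  open import Function.Bundles using (mk⇔)
  open import Relation.Nullary using (does)
  open import Relation.Nullary.Decidable using (does-⇔)
  import Data.Nat.Tactic.RingSolver as ℕSolver
  open BinaryDigits

  sumDigit carryOut : Bool → Bool → Bool → Bool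
  sumDigit α μ c = α xor μ xor c
  carryOut α μ c = (α ∧ μ) ∨ (c ∧ (α xor μ))

  full-adder : ∀ α μ c a v →
    digit α a ℕ.+ digit μ v ℕ.+ bit c ≡ digit (sumDigit α μ c) (a ℕ.+ v ℕ.+ bit (carryOut α μ c))
  full-adder α μ c a v = expanded α μ c a v
    where
    expanded : ∀ α μ c a v → bit α ℕ.+ 2 ℕ.* a ℕ.+ (bit μ ℕ.+ 2 ℕ.* v) ℕ.+ bit c ≡
                 bit (sumDigit α μ c) ℕ.+ 2 ℕ.* (a ℕ.+ v ℕ.+ bit (carryOut α μ c))
    expanded false false false = ℕSolver.solve-∀
    expanded false false true  = ℕSolver.solve-∀
    expanded false true  false = ℕSolver.solve-∀
    expanded false true  true  = ℕSolver.solve-∀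
    expanded true  false false = ℕSolver.solve-∀
    expanded true  false true  = ℕSolver.solve-∀
    expanded true  true  false = ℕSolver.solve-∀
    expanded true  true  true  = ℕSolver.solve-∀

  digit-< : ∀ o q N → does (digit o q <? 2 ℕ.* N) ≡ does (q <? N)
  digit-< o q N = does-⇔ (mk⇔ forward backward) (digit o q <? 2 ℕ.* N) (q <? N)
    where
    bit≤1 : ∀ o → bit o ≤ 1
    bit≤1 false = z≤n
    bit≤1 true  = s≤s z≤n
    forward : digit o q < 2 ℕ.* N → q < N
    forward o+2q<2N = ℕP.*-cancelˡ-< 2 q N (ℕP.≤-<-trans (ℕP.m≤n+m (2 ℕ.* q) (bit o)) o+2q<2N)
    backward : q < N → digit o q < 2 ℕ.* N
    backward q<N = begin-strict
      bit o ℕ.+ 2 ℕ.* q   ≤⟨ ℕP.+-monoˡ-≤ (2 ℕ.* q) (bit≤1 o) ⟩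
      1 ℕ.+ 2 ℕ.* q       <⟨ ℕP.n<1+n _ ⟩
      2 ℕ.+ 2 ℕ.* q       ≡⟨ ℕP.*-suc 2 q ⟨
      2 ℕ.* suc q         ≤⟨ ℕP.*-monoʳ-≤ 2 q<N ⟩
      2 ℕ.* N             ∎
      where open ℕP.≤-Reasoning

-- For a "kind" σ, a carry-in c, a shift v, a budget ℓ and
-- a length k, Count σ k c v ℓ counts the a < 2^k with a + v + c < 2^k
-- whose digit sum change w(a + v + c) - w(a) is ≥ k - ℓ (kind
-- σ = false) or ≤ ℓ - k (kind σ = true).  Splitting off the lowest
-- binary digits of a and of v expresses a count of length k+1 by counts
-- of length k with an updated carry and budget.
module Counts where
  open import Data.Bool using (_∧_)
  open import Data.Nat as ℕ using (suc; _∸_; _^_; _<?_)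
  open import Data.Integer as ℤ using (ℤ; _≤?_)
  import Data.Integer.Properties as ℤP
  open import Relation.Nullary using (does)
  open import Relation.Nullary.Decidable using (dec-false)
  open import Relation.Binary.PropositionalEquality using (refl; trans; cong; cong₂; module ≡-Reasoning)
  import Data.Integer.Tactic.RingSolver as ℤSolver
  open BinaryDigits
  open NaturalSums
  open FullAdder

  slack : Bool → ℕ → ℤ → ℕ → ℕ → ℤ
  slack false k ℓ ws wa = ((+ ws ℤ.- + wa) ℤ.- + k) ℤ.+ ℓ
  slack true  k ℓ ws wa = (ℓ ℤ.- + k) ℤ.- (+ ws ℤ.- + wa)

  -- The part of the budget ℓ used up by a digit α of a producing the
  -- digit o of s:  1 + α - o  (σ = false)  or  1 + o - α  (σ = true).
  cost : Bool → Bool → Bool → ℕ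
  cost false α o = 1 ℕ.+ bit α ∸ bit o
  cost true  α o = 1 ℕ.+ bit o ∸ bit α

  slack-step : ∀ σ α o k ℓ ws wa →
    slack σ (suc k) ℓ (bit o ℕ.+ ws) (bit α ℕ.+ wa) ≡ slack σ k (ℓ ℤ.- + cost σ α o) ws wa
  slack-step false α o k ℓ ws wa = begin
    ((+ (bit o ℕ.+ ws) ℤ.- + (bit α ℕ.+ wa)) ℤ.- + suc k) ℤ.+ ℓ
      ≡⟨ regroup (+ bit o) (+ bit α) (+ k) ℓ (+ ws) (+ wa) ⟩
    ((+ ws ℤ.- + wa) ℤ.- + k) ℤ.+ (ℓ ℤ.- ((+ 1 ℤ.+ + bit α) ℤ.- + bit o))
      ≡⟨ cong (λ d → ((+ ws ℤ.- + wa) ℤ.- + k) ℤ.+ (ℓ ℤ.- d)) (cost-value α o) ⟩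
    ((+ ws ℤ.- + wa) ℤ.- + k) ℤ.+ (ℓ ℤ.- + cost false α o) ∎
    where
    open ≡-Reasoning
    regroup : ∀ (O A k ℓ Ws Wa : ℤ) →
      (((O ℤ.+ Ws) ℤ.- (A ℤ.+ Wa)) ℤ.- (+ 1 ℤ.+ k)) ℤ.+ ℓ ≡ ((Ws ℤ.- Wa) ℤ.- k) ℤ.+ (ℓ ℤ.- ((+ 1 ℤ.+ A) ℤ.- O))
    regroup = ℤSolver.solve-∀
    cost-value : ∀ α o → (+ 1 ℤ.+ + bit α) ℤ.- + bit o ≡ + cost false α o
    cost-value false false = refl
    cost-value false true  = refl
    cost-value true  false = refl
    cost-value true  true  = refl
  slack-step true α o k ℓ ws wa = begin
    (ℓ ℤ.- + suc k) ℤ.- (+ (bit o ℕ.+ ws) ℤ.- + (bit α ℕ.+ wa))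
      ≡⟨ regroup (+ bit o) (+ bit α) (+ k) ℓ (+ ws) (+ wa) ⟩
    ((ℓ ℤ.- ((+ 1 ℤ.+ + bit o) ℤ.- + bit α)) ℤ.- + k) ℤ.- (+ ws ℤ.- + wa)
      ≡⟨ cong (λ d → ((ℓ ℤ.- d) ℤ.- + k) ℤ.- (+ ws ℤ.- + wa)) (cost-value α o) ⟩
    ((ℓ ℤ.- + cost true α o) ℤ.- + k) ℤ.- (+ ws ℤ.- + wa) ∎
    where
    open ≡-Reasoning
    regroup : ∀ (O A k ℓ Ws Wa : ℤ) →
      (ℓ ℤ.- (+ 1 ℤ.+ k)) ℤ.- ((O ℤ.+ Ws) ℤ.- (A ℤ.+ Wa)) ≡ ((ℓ ℤ.- ((+ 1 ℤ.+ O) ℤ.- A)) ℤ.- k) ℤ.- (Ws ℤ.- Wa)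
    regroup = ℤSolver.solve-∀
    cost-value : ∀ α o → (+ 1 ℤ.+ + bit o) ℤ.- + bit α ≡ + cost true α o
    cost-value false false = refl
    cost-value false true  = refl
    cost-value true  false = refl
    cost-value true  true  = refl

  counted : Bool → ℕ → Bool → ℕ → ℤ → ℕ → Bool
  counted σ k c v ℓ a =
    does (a ℕ.+ v ℕ.+ bit c <? 2 ^ k) ∧ does (+ 0 ≤? slack σ k ℓ (w (a ℕ.+ v ℕ.+ bit c)) (w a))

  Count : Bool → ℕ → Bool → ℕ → ℤ → ℕ
  Count σ k c v ℓ = sumBelow (2 ^ k) (λ a → indicator (counted σ k c v ℓ a))

  counted-step : ∀ σ k c μ v ℓ α a →
    counted σ (suc k) c (digit μ v) ℓ (digit α a) ≡
    counted σ k (carryOut α μ c) v (ℓ ℤ.- + cost σ α (sumDigit α μ c)) a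
  counted-step σ k c μ v ℓ α a
    rewrite full-adder α μ c a v
          | digit-< (sumDigit α μ c) (a ℕ.+ v ℕ.+ bit (carryOut α μ c)) (2 ^ k)
          | w-digit (sumDigit α μ c) (a ℕ.+ v ℕ.+ bit (carryOut α μ c))
          | w-digit α a
          | slack-step σ α (sumDigit α μ c) k ℓ (w (a ℕ.+ v ℕ.+ bit (carryOut α μ c))) (w a) = refl

  Count-step : ∀ σ k c μ v ℓ →
    Count σ (suc k) c (digit μ v) ℓ ≡ Σ₂ (λ α → Count σ k (carryOut α μ c) v (ℓ ℤ.- + cost σ α (sumDigit α μ c)))
  Count-step σ k c μ v ℓ = begin
    sumBelow (2 ℕ.* 2 ^ k) (λ a → indicator (counted σ (suc k) c (digit μ v) ℓ a))
      ≡⟨ sumBelow-double (2 ^ k) _ ⟩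
    sumBelow (2 ^ k) (λ a → Σ₂ (λ α → indicator (counted σ (suc k) c (digit μ v) ℓ (digit α a))))
      ≡⟨ sumBelow-cong (2 ^ k) (λ a _ → cong₂ ℕ._+_ (step false a) (step true a)) ⟩
    sumBelow (2 ^ k) (λ a → Σ₂ (λ α → indicator (next α a)))
      ≡⟨ sumBelow-Σ₂ (2 ^ k) (λ a α → indicator (next α a)) ⟩
    Σ₂ (λ α → Count σ k (carryOut α μ c) v (ℓ ℤ.- + cost σ α (sumDigit α μ c))) ∎
    where
    open ≡-Reasoning
    next : Bool → ℕ → Bool
    next α = counted σ k (carryOut α μ c) v (ℓ ℤ.- + cost σ α (sumDigit α μ c))
    step : ∀ α a → indicator (counted σ (suc k) c (digit μ v) ℓ (digit α a)) ≡ indicator (next α a)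
    step α a = cong indicator (counted-step σ k c μ v ℓ α a)

  -- Length 0: only a = 0, v = 0 and no carry, counted iff ℓ ≥ 0.
  initial : Bool → ℤ → ℕ
  initial false ℓ = indicator (does (+ 0 ≤? ℓ))
  initial true  ℓ = 0

  Count-base : ∀ σ c ℓ → Count σ 0 c 0 ℓ ≡ initial c ℓ
  Count-base false false ℓ = cong (λ x → indicator (does (+ 0 ≤? x))) (ℤP.+-identityˡ ℓ)
  Count-base true  false ℓ = cong (λ x → indicator (does (+ 0 ≤? x))) (trans (ℤP.+-identityʳ _) (ℤP.+-identityʳ ℓ))
  Count-base σ     true  ℓ = refl

  initial-negative : ∀ c {ℓ} → ℓ ℤ.< + 0 → initial c ℓ ≡ 0
  initial-negative false ℓ<0 = cong indicator (dec-false (+ 0 ≤? _) (ℤP.<⇒≱ ℓ<0))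
  initial-negative true  ℓ<0 = refl

module PairCounts where
  open import Data.Bool using (not)
  open import Data.Nat as ℕ using (zero; suc; _∸_; _≤_; _<_; s≤s; _^_)
  import Data.Nat.Properties as ℕP
  open import Data.Integer as ℤ using (ℤ)
  import Data.Integer.Properties as ℤP
  open import Data.Sum using (_⊎_; inj₁; inj₂)
  open import Relation.Binary.PropositionalEquality using (refl; sym; cong; cong₂; module ≡-Reasoning)
  import Data.Nat.Tactic.RingSolver as ℕSolver
  open BinaryDigits
  open NaturalSums
  open FullAdder
  open Counts

  shift : Bool → ℕ → ℕ → ℕ
  shift false k t = compl t k
  shift true  k t = t

  shiftDigit : Bool → Bool → Bool
  shiftDigit false tb = not tb
  shiftDigit true  tb = tb

  complement-split : ∀ {t n} → t < n → n ≡ suc ((n ∸ 1) ∸ t ℕ.+ t)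
  complement-split {n = suc n} (s≤s t≤n) = cong suc (sym (ℕP.m∸n+n≡m t≤n))

  compl-compl : ∀ {t k} → t < 2 ^ k → compl (compl t k) k ≡ t
  compl-compl t<2ᵏ = ℕP.m∸[m∸n]≡n (below-pred t<2ᵏ)
    where
    below-pred : ∀ {t n} → t < n → t ≤ n ∸ 1
    below-pred {n = suc n} (s≤s t≤n) = t≤n

  shift-digit : ∀ σ k tb t → t < 2 ^ k → shift σ (suc k) (digit tb t) ≡ digit (shiftDigit σ tb) (shift σ k t)
  shift-digit true  k tb t _   = refl
  shift-digit false k tb t t<2ᵏ = begin
    (2 ℕ.* 2 ^ k ∸ 1) ∸ digit tb t                 ≡⟨ cong (λ n → (2 ℕ.* n ∸ 1) ∸ digit tb t) (complement-split t<2ᵏ) ⟩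
    (2 ℕ.* suc (r ℕ.+ t) ∸ 1) ∸ digit tb t         ≡⟨ cong (λ n → (n ∸ 1) ∸ digit tb t) (ℕP.*-suc 2 (r ℕ.+ t)) ⟩
    (1 ℕ.+ 2 ℕ.* (r ℕ.+ t)) ∸ digit tb t           ≡⟨ cong (_∸ digit tb t) (complement tb r t) ⟩
    (digit (not tb) r ℕ.+ digit tb t) ∸ digit tb t ≡⟨ ℕP.m+n∸n≡m (digit (not tb) r) (digit tb t) ⟩
    digit (not tb) r                               ∎
    where
    open ≡-Reasoning
    r = (2 ^ k ∸ 1) ∸ t
    complement : ∀ b r t → 1 ℕ.+ 2 ℕ.* (r ℕ.+ t) ≡ digit (not b) r ℕ.+ digit b t
    complement false = expanded
      where expanded : ∀ r t → 1 ℕ.+ 2 ℕ.* (r ℕ.+ t) ≡ (1 ℕ.+ 2 ℕ.* r) ℕ.+ (0 ℕ.+ 2 ℕ.* t)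
            expanded = ℕSolver.solve-∀
    complement true  = expanded
      where expanded : ∀ r t → 1 ℕ.+ 2 ℕ.* (r ℕ.+ t) ≡ (0 ℕ.+ 2 ℕ.* r) ℕ.+ (1 ℕ.+ 2 ℕ.* t)
            expanded = ℕSolver.solve-∀

  nextCarry : Bool → Bool → Bool → Bool → Bool
  nextCarry σ tb α c = carryOut α (shiftDigit σ tb) c

  stepCost : Bool → Bool → Bool → Bool → ℕ
  stepCost σ tb α c = cost σ α (sumDigit α (shiftDigit σ tb) c)

  Pairs : Bool → Bool → ℕ → Bool → Bool → ℤ → ℤ → ℕ
  Pairs σ₁ σ₂ k c₁ c₂ ℓ m =
    sumBelow (2 ^ k) (λ t → Count σ₁ k c₁ (shift σ₁ k t) ℓ ℕ.* Count σ₂ k c₂ (shift σ₂ k t) m)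

  Pairs-next : Bool → Bool → ℕ → Bool → Bool → ℤ → ℤ → Bool → Bool → Bool → ℕ
  Pairs-next σ₁ σ₂ k c₁ c₂ ℓ m tb α β =
    Pairs σ₁ σ₂ k (nextCarry σ₁ tb α c₁) (nextCarry σ₂ tb β c₂)
                  (ℓ ℤ.- + stepCost σ₁ tb α c₁) (m ℤ.- + stepCost σ₂ tb β c₂)

  Pairs-step : ∀ σ₁ σ₂ k c₁ c₂ ℓ m →
    Pairs σ₁ σ₂ (suc k) c₁ c₂ ℓ m ≡ Σ₂ (λ tb → Σ₂ λ α → Σ₂ λ β → Pairs-next σ₁ σ₂ k c₁ c₂ ℓ m tb α β)
  Pairs-step σ₁ σ₂ k c₁ c₂ ℓ m = begin
    sumBelow (2 ℕ.* 2 ^ k) product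
      ≡⟨ sumBelow-double (2 ^ k) product ⟩
    sumBelow (2 ^ k) (λ t → Σ₂ λ tb → product (digit tb t))
      ≡⟨ sumBelow-cong (2 ^ k) (λ t t<2ᵏ → cong₂ ℕ._+_ (split t t<2ᵏ false) (split t t<2ᵏ true)) ⟩
    sumBelow (2 ^ k) (λ t → Σ₂ λ tb → Σ₂ λ α → Σ₂ λ β → term t tb α β)
      ≡⟨ sumBelow-Σ₂³ (2 ^ k) term ⟩
    Σ₂ (λ tb → Σ₂ λ α → Σ₂ λ β → Pairs-next σ₁ σ₂ k c₁ c₂ ℓ m tb α β) ∎
    where
    open ≡-Reasoning
    product : ℕ → ℕ
    product t = Count σ₁ (suc k) c₁ (shift σ₁ (suc k) t) ℓ ℕ.* Count σ₂ (suc k) c₂ (shift σ₂ (suc k) t) m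
    count₁ count₂ : ℕ → Bool → Bool → ℕ
    count₁ t tb α = Count σ₁ k (nextCarry σ₁ tb α c₁) (shift σ₁ k t) (ℓ ℤ.- + stepCost σ₁ tb α c₁)
    count₂ t tb β = Count σ₂ k (nextCarry σ₂ tb β c₂) (shift σ₂ k t) (m ℤ.- + stepCost σ₂ tb β c₂)
    term : ℕ → Bool → Bool → Bool → ℕ
    term t tb α β = count₁ t tb α ℕ.* count₂ t tb β
    split : ∀ t → t < 2 ^ k → ∀ tb → product (digit tb t) ≡ Σ₂ λ α → Σ₂ λ β → term t tb α β
    split t t<2ᵏ tb
      rewrite shift-digit σ₁ k tb t t<2ᵏ | shift-digit σ₂ k tb t t<2ᵏ
            | Count-step σ₁ k c₁ (shiftDigit σ₁ tb) (shift σ₁ k t) ℓ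
            | Count-step σ₂ k c₂ (shiftDigit σ₂ tb) (shift σ₂ k t) m
      = Σ₂-product (count₁ t tb) (count₂ t tb)

  shift-0 : ∀ σ → shift σ 0 0 ≡ 0
  shift-0 false = refl
  shift-0 true  = refl

  Pairs-base : ∀ σ₁ σ₂ c₁ c₂ ℓ m → Pairs σ₁ σ₂ 0 c₁ c₂ ℓ m ≡ initial c₁ ℓ ℕ.* initial c₂ m
  Pairs-base σ₁ σ₂ c₁ c₂ ℓ m rewrite shift-0 σ₁ | shift-0 σ₂ =
    cong₂ ℕ._*_ (Count-base σ₁ c₁ ℓ) (Count-base σ₂ c₂ m)

  Pairs-negative : ∀ σ₁ σ₂ k c₁ c₂ {ℓ m} → ℓ ℤ.< + 0 ⊎ m ℤ.< + 0 → Pairs σ₁ σ₂ k c₁ c₂ ℓ m ≡ 0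
  Pairs-negative σ₁ σ₂ zero c₁ c₂ {ℓ} {m} (inj₁ ℓ<0)
    rewrite Pairs-base σ₁ σ₂ c₁ c₂ ℓ m | initial-negative c₁ ℓ<0 = refl
  Pairs-negative σ₁ σ₂ zero c₁ c₂ {ℓ} {m} (inj₂ m<0)
    rewrite Pairs-base σ₁ σ₂ c₁ c₂ ℓ m | initial-negative c₂ m<0 = ℕP.*-zeroʳ (initial c₁ ℓ)
  Pairs-negative σ₁ σ₂ (suc k) c₁ c₂ {ℓ} {m} negative
    rewrite Pairs-step σ₁ σ₂ k c₁ c₂ ℓ m =
    Σ₂-zero λ tb → Σ₂-zero λ α → Σ₂-zero λ β →
      Pairs-negative σ₁ σ₂ k (nextCarry σ₁ tb α c₁) (nextCarry σ₂ tb β c₂)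
        (still-negative {stepCost σ₁ tb α c₁} {stepCost σ₂ tb β c₂} negative)
    where
    still-negative : ∀ {d e} → ℓ ℤ.< + 0 ⊎ m ℤ.< + 0 → ℓ ℤ.- + d ℤ.< + 0 ⊎ m ℤ.- + e ℤ.< + 0
    still-negative {d} (inj₁ ℓ<0) = inj₁ (ℤP.≤-<-trans (ℤP.i-j≤i ℓ (+ d)) ℓ<0)
    still-negative {e = e} (inj₂ m<0) = inj₂ (ℤP.≤-<-trans (ℤP.i-j≤i m (+ e)) m<0)

module PaperQuantities where
  open import Data.Bool using (_∧_)
  open import Data.Nat as ℕ using (suc; _<_; s≤s; _^_; _<?_)
  import Data.Nat.Properties as ℕP
  open import Data.Integer as ℤ using (ℤ; _≤?_)
  import Data.Integer.Properties as ℤP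
  open import Function.Bundles using (mk⇔)
  open import Relation.Nullary using (does)
  open import Relation.Nullary.Decidable using (does-⇔)
  open import Relation.Binary.PropositionalEquality using (refl; trans; cong; cong₂; module ≡-Reasoning)
  import Data.Integer.Tactic.RingSolver as ℤSolver
  open BinaryDigits
  open NaturalSums
  open Counts
  open PairCounts

  range-shift : ∀ a v r → does (a ℕ.+ v ℕ.+ 0 <? suc (v ℕ.+ r)) ≡ does (a <? suc r)
  range-shift a v r = does-⇔ (mk⇔ forward backward) (a ℕ.+ v ℕ.+ 0 <? suc (v ℕ.+ r)) (a <? suc r)
    where
    forward : a ℕ.+ v ℕ.+ 0 < suc (v ℕ.+ r) → a < suc r
    forward (s≤s a+v≤v+r) rewrite ℕP.+-identityʳ (a ℕ.+ v) | ℕP.+-comm v r =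
      s≤s (ℕP.+-cancelʳ-≤ v a r a+v≤v+r)
    backward : a < suc r → a ℕ.+ v ℕ.+ 0 < suc (v ℕ.+ r)
    backward (s≤s a≤r) rewrite ℕP.+-identityʳ (a ℕ.+ v) | ℕP.+-comm v r =
      s≤s (ℕP.+-monoˡ-≤ v a≤r)

  ≤-as-difference : ∀ x y {z : ℤ} → x ℤ.- y ≡ z → does (y ≤? x) ≡ does (+ 0 ≤? z)
  ≤-as-difference x y refl =
    does-⇔ (mk⇔ ℤP.i≤j⇒0≤j-i ℤP.0≤i-j⇒j≤i) (y ≤? x) (+ 0 ≤? x ℤ.- y)

  count-as-Count : ∀ σ k v r ℓ (P : ℕ → Bool) → 2 ^ k ≡ suc (v ℕ.+ r) →
    (∀ a → P a ≡ does (+ 0 ≤? slack σ k ℓ (w (a ℕ.+ v ℕ.+ 0)) (w a))) → count P r ≡ Count σ k false v ℓ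
  count-as-Count σ k v r ℓ P 2ᵏ≡1+v+r P≡slack = begin
    count P r
      ≡⟨ count-as-sumBelow P r<2ᵏ ⟩
    sumBelow (2 ^ k) (λ a → indicator (does (a <? suc r) ∧ P a))
      ≡⟨ sumBelow-cong (2 ^ k) (λ a _ → cong indicator (condition a)) ⟩
    Count σ k false v ℓ ∎
    where
    open ≡-Reasoning
    r<2ᵏ : r < 2 ^ k
    r<2ᵏ rewrite 2ᵏ≡1+v+r = s≤s (ℕP.m≤n+m r v)
    condition : ∀ a → (does (a <? suc r) ∧ P a) ≡ counted σ k false v ℓ a
    condition a rewrite 2ᵏ≡1+v+r | range-shift a v r | P≡slack a = refl

  Γ-as-Counts : ∀ t k ℓ → t < 2 ^ k →
    Γ t k (+ k ℤ.- + ℓ) ≡ Σ₂ (λ σ → Count σ k false (shift σ k t) (+ ℓ))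
  Γ-as-Counts t k ℓ t<2ᵏ = cong₂ ℕ._+_
    (count-as-Count false k (compl t k) t (+ ℓ) _ (complement-split t<2ᵏ) first)
    (count-as-Count true k t (compl t k) (+ ℓ) _ (trans (complement-split t<2ᵏ) (cong suc (ℕP.+-comm (compl t k) t))) second)
    where
    j = + k ℤ.- + ℓ
    first : ∀ a → does (j ≤? δ (compl t k) a) ≡ does (+ 0 ≤? slack false k (+ ℓ) (w (a ℕ.+ compl t k ℕ.+ 0)) (w a))
    first a rewrite ℕP.+-identityʳ (a ℕ.+ compl t k) =
      ≤-as-difference (δ (compl t k) a) j (regroup (+ k) (+ ℓ) (+ w (a ℕ.+ compl t k)) (+ w a))
      where
      regroup : ∀ (K L A B : ℤ) → (A ℤ.- B) ℤ.- (K ℤ.- L) ≡ ((A ℤ.- B) ℤ.- K) ℤ.+ L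
      regroup = ℤSolver.solve-∀
    second : ∀ a → does (δ (compl (compl t k) k) a ≤? ℤ.- j) ≡ does (+ 0 ≤? slack true k (+ ℓ) (w (a ℕ.+ t ℕ.+ 0)) (w a))
    second a rewrite ℕP.+-identityʳ (a ℕ.+ t) =
      trans (cong (λ s → does (δ s a ≤? ℤ.- j)) (compl-compl {t} {k} t<2ᵏ))
            (≤-as-difference (ℤ.- j) (δ t a) (regroup (+ k) (+ ℓ) (+ w (a ℕ.+ t)) (+ w a)))
      where
      regroup : ∀ (K L A B : ℤ) → ℤ.- (K ℤ.- L) ℤ.- (A ℤ.- B) ≡ (L ℤ.- K) ℤ.- (A ℤ.- B)
      regroup = ℤSolver.solve-∀

  M2-as-Pairs : ∀ k ℓ m → M2 k ℓ m ≡ Σ₂ (λ σ₁ → Σ₂ λ σ₂ → Pairs σ₁ σ₂ k false false (+ ℓ) (+ m))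
  M2-as-Pairs k ℓ m = begin
    M2 k ℓ m
      ≡⟨ sumBelow-cong (2 ^ k) (λ t t<2ᵏ → cong₂ ℕ._*_ (Γ-as-Counts t k ℓ t<2ᵏ) (Γ-as-Counts t k m t<2ᵏ)) ⟩
    sumBelow (2 ^ k) (λ t → Σ₂ (counts ℓ t) ℕ.* Σ₂ (counts m t))
      ≡⟨ sumBelow-cong (2 ^ k) (λ t _ → Σ₂-product (counts ℓ t) (counts m t)) ⟩
    sumBelow (2 ^ k) (λ t → Σ₂ λ σ₁ → Σ₂ λ σ₂ → counts ℓ t σ₁ ℕ.* counts m t σ₂)
      ≡⟨ sumBelow-Σ₂² (2 ^ k) (λ t σ₁ σ₂ → counts ℓ t σ₁ ℕ.* counts m t σ₂) ⟩
    Σ₂ (λ σ₁ → Σ₂ λ σ₂ → Pairs σ₁ σ₂ k false false (+ ℓ) (+ m)) ∎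
    where
    open ≡-Reasoning
    counts : ℕ → ℕ → Bool → ℕ
    counts x t σ = Count σ k false (shift σ k t) (+ x)

module VariableShifts where
  open import Data.Nat as ℕ using (zero; suc; _∸_; _<_; s≤s)
  open import Data.Integer as ℤ using (ℤ)
  import Data.Integer.Properties as ℤP
  open import Relation.Binary.PropositionalEquality using (refl; trans; module ≡-Reasoning)
  open IntegerSums
  open ≡-Reasoning

  X-⊛-zero : ∀ a l m → (X ⊛ a) 0 l m ≡ + 0
  X-⊛-zero a l m = sumUpTo-zero l _ (λ j _ → sumUpTo-zero m _ (λ h _ → refl))

  X-⊛-suc : ∀ a k l m → (X ⊛ a) (suc k) l m ≡ a k l m
  X-⊛-suc a k l m = begin
    (X ⊛ a) (suc k) l m
      ≡⟨ sumUpTo-only-1 k _ (X-⊛-zero (λ i j h → a (k ∸ i) j h) l m)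
           (λ i → sumUpTo-zero l _ (λ j _ → sumUpTo-zero m _ (λ h _ → refl))) ⟩
    sumUpTo l (λ j → sumUpTo m (λ h → X 1 j h ℤ.* a k (l ∸ j) (m ∸ h)))
      ≡⟨ sumUpTo-only-0 l _ (λ j → sumUpTo-zero m _ (λ h _ → refl)) ⟩
    sumUpTo m (λ h → X 1 0 h ℤ.* a k l (m ∸ h))
      ≡⟨ sumUpTo-only-0 m _ (λ h → refl) ⟩
    + 1 ℤ.* a k l m
      ≡⟨ ℤP.*-identityˡ _ ⟩
    a k l m ∎

  Y-⊛-zero : ∀ a k m → (Y ⊛ a) k 0 m ≡ + 0
  Y-⊛-zero a k m = sumUpTo-zero k _ (λ i _ → sumUpTo-zero m _ (λ h _ → no-y⁰ i h))
    where
    no-y⁰ : ∀ i h → Y i 0 h ℤ.* a (k ∸ i) 0 (m ∸ h) ≡ + 0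
    no-y⁰ zero    h = refl
    no-y⁰ (suc i) h = refl

  Y-⊛-suc : ∀ a k l m → (Y ⊛ a) k (suc l) m ≡ a k l m
  Y-⊛-suc a k l m = begin
    (Y ⊛ a) k (suc l) m
      ≡⟨ sumUpTo-only-0 k _ (λ i → sumUpTo-zero (suc l) _ (λ j _ → sumUpTo-zero m _ (λ h _ → refl))) ⟩
    sumUpTo (suc l) (λ j → sumUpTo m (λ h → Y 0 j h ℤ.* a k (suc l ∸ j) (m ∸ h)))
      ≡⟨ sumUpTo-only-1 l _ (sumUpTo-zero m _ (λ h _ → refl)) (λ j → sumUpTo-zero m _ (λ h _ → refl)) ⟩
    sumUpTo m (λ h → Y 0 1 h ℤ.* a k l (m ∸ h))
      ≡⟨ sumUpTo-only-0 m _ (λ h → refl) ⟩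
    + 1 ℤ.* a k l m
      ≡⟨ ℤP.*-identityˡ _ ⟩
    a k l m ∎

  Z-⊛-zero : ∀ a k l → (Z ⊛ a) k l 0 ≡ + 0
  Z-⊛-zero a k l = sumUpTo-zero k _ (λ i _ → sumUpTo-zero l _ (λ j _ → no-z⁰ i j))
    where
    no-z⁰ : ∀ i j → Z i j 0 ℤ.* a (k ∸ i) (l ∸ j) 0 ≡ + 0
    no-z⁰ zero    zero    = refl
    no-z⁰ zero    (suc j) = refl
    no-z⁰ (suc i) j       = refl

  Z-⊛-suc : ∀ a k l m → (Z ⊛ a) k l (suc m) ≡ a k l m
  Z-⊛-suc a k l m = begin
    (Z ⊛ a) k l (suc m)
      ≡⟨ sumUpTo-only-0 k _ (λ i → sumUpTo-zero l _ (λ j _ → sumUpTo-zero (suc m) _ (λ h _ → refl))) ⟩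
    sumUpTo l (λ j → sumUpTo (suc m) (λ h → Z 0 j h ℤ.* a k (l ∸ j) (suc m ∸ h)))
      ≡⟨ sumUpTo-only-0 l _ (λ j → sumUpTo-zero (suc m) _ (λ h _ → refl)) ⟩
    sumUpTo (suc m) (λ h → Z 0 0 h ℤ.* a k l (suc m ∸ h))
      ≡⟨ sumUpTo-only-1 m _ refl (λ h → refl) ⟩
    + 1 ℤ.* a k l m
      ≡⟨ ℤP.*-identityˡ _ ⟩
    a k l m ∎

  yPow zPow : ℕ → Series → Series
  yPow zero    a = a
  yPow (suc d) a = Y ⊛ yPow d a
  zPow zero    a = a
  zPow (suc d) a = Z ⊛ zPow d a

  yPow-above : ∀ d a k l m → yPow d a k (d ℕ.+ l) m ≡ a k l m
  yPow-above zero    a k l m = refl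
  yPow-above (suc d) a k l m = trans (Y-⊛-suc (yPow d a) k (d ℕ.+ l) m) (yPow-above d a k l m)

  yPow-below : ∀ d a k l m → l < d → yPow d a k l m ≡ + 0
  yPow-below (suc d) a k zero    m _         = Y-⊛-zero (yPow d a) k m
  yPow-below (suc d) a k (suc l) m (s≤s l<d) = trans (Y-⊛-suc (yPow d a) k l m) (yPow-below d a k l m l<d)

  zPow-above : ∀ d a k l m → zPow d a k l (d ℕ.+ m) ≡ a k l m
  zPow-above zero    a k l m = refl
  zPow-above (suc d) a k l m = trans (Z-⊛-suc (zPow d a) k l (d ℕ.+ m)) (zPow-above d a k l m)

  zPow-below : ∀ d a k l m → m < d → zPow d a k l m ≡ + 0
  zPow-below (suc d) a k l zero    _         = Z-⊛-zero (zPow d a) k l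
  zPow-below (suc d) a k l (suc m) (s≤s m<d) = trans (Z-⊛-suc (zPow d a) k l m) (zPow-below d a k l m m<d)

-- The generating series of the pair counts satisfy a linear system:
-- the coefficient of x^{k+1} is obtained from those of x^k by the digit
-- step, which lowers the budgets l, m by the step costs, i.e. multiplies
-- by y^{cost₁} z^{cost₂}.
module PairSystem where
  open import Data.Nat as ℕ using (zero; suc; _∸_; _≤_; _<_; _<?_)
  import Data.Nat.Properties as ℕP
  open import Data.Integer as ℤ using (ℤ)
  import Data.Integer.Properties as ℤP
  open import Data.Sum using (inj₁; inj₂)
  open import Relation.Nullary using (yes; no)
  open import Relation.Binary.PropositionalEquality using (refl; sym; trans; cong; cong₂; module ≡-Reasoning)
  open SeriesRing using (_≈_)
  open Constants using (const-⊛)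
  open VariableShifts
  open NaturalSums
  open Counts using (initial)
  open PairCounts
  open ≡-Reasoning

  PairSeries : Bool → Bool → Bool → Bool → Series
  PairSeries σ₁ σ₂ c₁ c₂ k l m = + Pairs σ₁ σ₂ k c₁ c₂ (+ l) (+ m)

  budget-negative : ∀ {l d} → l < d → + l ℤ.- + d ℤ.< + 0
  budget-negative {l} {d} l<d rewrite ℤP.[+m]-[+n]≡m⊖n l d | ℤP.⊖-< l<d with d ∸ l | ℕP.m<n⇒0<n∸m l<d
  ... | suc _ | _ = ℤ.-<+

  budget-remaining : ∀ {l d} → d ≤ l → + l ℤ.- + d ≡ + (l ∸ d)
  budget-remaining {l} {d} d≤l = trans (ℤP.[+m]-[+n]≡m⊖n l d) (ℤP.⊖-≥ d≤l)

  zPow-PairSeries : ∀ σ₁ σ₂ c₁ c₂ e k l m →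
    zPow e (PairSeries σ₁ σ₂ c₁ c₂) k l m ≡ + Pairs σ₁ σ₂ k c₁ c₂ (+ l) (+ m ℤ.- + e)
  zPow-PairSeries σ₁ σ₂ c₁ c₂ e k l m with m <? e
  ... | yes m<e = trans (zPow-below e _ k l m m<e)
                        (cong +_ (sym (Pairs-negative σ₁ σ₂ k c₁ c₂ (inj₂ (budget-negative m<e)))))
  ... | no m≮e = begin
    zPow e S k l m                  ≡⟨ cong (zPow e S k l) (sym (ℕP.m+[n∸m]≡n e≤m)) ⟩
    zPow e S k l (e ℕ.+ (m ∸ e))    ≡⟨ zPow-above e S k l (m ∸ e) ⟩
    + Pairs σ₁ σ₂ k c₁ c₂ (+ l) (+ (m ∸ e))
      ≡⟨ cong (λ b → + Pairs σ₁ σ₂ k c₁ c₂ (+ l) b) (budget-remaining e≤m) ⟨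
    + Pairs σ₁ σ₂ k c₁ c₂ (+ l) (+ m ℤ.- + e)   ∎
    where
    S = PairSeries σ₁ σ₂ c₁ c₂
    e≤m = ℕP.≮⇒≥ m≮e

  yzPow-PairSeries : ∀ σ₁ σ₂ c₁ c₂ d e k l m →
    yPow d (zPow e (PairSeries σ₁ σ₂ c₁ c₂)) k l m ≡ + Pairs σ₁ σ₂ k c₁ c₂ (+ l ℤ.- + d) (+ m ℤ.- + e)
  yzPow-PairSeries σ₁ σ₂ c₁ c₂ d e k l m with l <? d
  ... | yes l<d = trans (yPow-below d _ k l m l<d)
                        (cong +_ (sym (Pairs-negative σ₁ σ₂ k c₁ c₂ (inj₁ (budget-negative l<d)))))
  ... | no l≮d = begin
    yPow d S k l m                                     ≡⟨ cong (λ x → yPow d S k x m) (sym (ℕP.m+[n∸m]≡n d≤l)) ⟩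
    yPow d S k (d ℕ.+ (l ∸ d)) m                       ≡⟨ yPow-above d S k (l ∸ d) m ⟩
    S k (l ∸ d) m                                      ≡⟨ zPow-PairSeries σ₁ σ₂ c₁ c₂ e k (l ∸ d) m ⟩
    + Pairs σ₁ σ₂ k c₁ c₂ (+ (l ∸ d)) (+ m ℤ.- + e)
      ≡⟨ cong (λ b → + Pairs σ₁ σ₂ k c₁ c₂ b (+ m ℤ.- + e)) (budget-remaining d≤l) ⟨
    + Pairs σ₁ σ₂ k c₁ c₂ (+ l ℤ.- + d) (+ m ℤ.- + e) ∎
    where
    S = zPow e (PairSeries σ₁ σ₂ c₁ c₂)
    d≤l = ℕP.≮⇒≥ l≮d

  -- Σ_{l,m} y^l z^m, the generating function of the length-0 counts.
  AllYZ : Series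
  AllYZ zero    l m = + 1
  AllYZ (suc k) l m = + 0

  Σ₂ˢ : (Bool → Series) → Series
  Σ₂ˢ f = f false ⊕ f true

  noCarry : Bool → ℕ
  noCarry false = 1
  noCarry true  = 0

  step-term : Bool → Bool → Bool → Bool → Bool → Bool → Bool → Series
  step-term σ₁ σ₂ c₁ c₂ tb α β = yPow (stepCost σ₁ tb α c₁) (zPow (stepCost σ₂ tb β c₂)
    (PairSeries σ₁ σ₂ (nextCarry σ₁ tb α c₁) (nextCarry σ₂ tb β c₂)))

  step-series : Bool → Bool → Bool → Bool → Series
  step-series σ₁ σ₂ c₁ c₂ = Σ₂ˢ λ tb → Σ₂ˢ λ α → Σ₂ˢ λ β → step-term σ₁ σ₂ c₁ c₂ tb α β

  system : ∀ σ₁ σ₂ c₁ c₂ →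
    PairSeries σ₁ σ₂ c₁ c₂ ≈ const (+ (noCarry c₁ ℕ.* noCarry c₂)) ⊛ AllYZ ⊕ X ⊛ step-series σ₁ σ₂ c₁ c₂
  system σ₁ σ₂ c₁ c₂ zero l m
    rewrite Pairs-base σ₁ σ₂ c₁ c₂ (+ l) (+ m) | const-⊛ (+ (noCarry c₁ ℕ.* noCarry c₂)) AllYZ 0 l m
          | X-⊛-zero (step-series σ₁ σ₂ c₁ c₂) l m
    = initial-term c₁ c₂
    where
    initial-nonneg : ∀ c n → initial c (+ n) ≡ noCarry c
    initial-nonneg false n = refl
    initial-nonneg true  n = refl
    initial-term : ∀ c₁ c₂ → + (initial c₁ (+ l) ℕ.* initial c₂ (+ m)) ≡ + (noCarry c₁ ℕ.* noCarry c₂) ℤ.* + 1 ℤ.+ + 0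
    initial-term c₁ c₂ = trans (cong₂ (λ a b → + (a ℕ.* b)) (initial-nonneg c₁ l) (initial-nonneg c₂ m))
                               (sym (trans (ℤP.+-identityʳ _) (ℤP.*-identityʳ _)))
  system σ₁ σ₂ c₁ c₂ (suc k) l m
    rewrite Pairs-step σ₁ σ₂ k c₁ c₂ (+ l) (+ m) | const-⊛ (+ (noCarry c₁ ℕ.* noCarry c₂)) AllYZ (suc k) l m
          | ℤP.*-zeroʳ (+ (noCarry c₁ ℕ.* noCarry c₂)) | X-⊛-suc (step-series σ₁ σ₂ c₁ c₂) k l m
    = trans (Σ₂-coefficient (λ tb → Σ₂ˢ λ α → Σ₂ˢ (term tb α)) λ tb →
             Σ₂-coefficient (λ α → Σ₂ˢ (term tb α)) λ α →
             Σ₂-coefficient (term tb α) λ β →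
               sym (yzPow-PairSeries σ₁ σ₂ _ _ (stepCost σ₁ tb α c₁) (stepCost σ₂ tb β c₂) k l m))
            (sym (ℤP.+-identityˡ _))
    where
    term = step-term σ₁ σ₂ c₁ c₂
    Σ₂-coefficient : ∀ {f : Bool → ℕ} (g : Bool → Series) → (∀ b → + f b ≡ g b k l m) → + Σ₂ f ≡ Σ₂ˢ g k l m
    Σ₂-coefficient g f≡g = cong₂ ℤ._+_ (f≡g false) (f≡g true)

-- Reasoning about series equations that follow from others by ring
-- arithmetic: an equation lhs = rhs holds when lhs - rhs is a linear
-- combination of differences L - R of equations L = R known to hold.
module LinearCombinations where
  import Data.Integer.Properties as ℤP
  open import Relation.Binary.PropositionalEquality using (refl; trans)
  open SeriesRing
  open CommutativeRing seriesRing using (zeroʳ; *-cong) renaming (refl to ≈-refl)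

  combination : ∀ {lhs rhs t} → lhs ≈ rhs ⊕ t → t ≈ 𝟘 → lhs ≈ rhs
  combination {rhs = rhs} lhs≈rhs+t t≈0 k l m rewrite lhs≈rhs+t k l m | t≈0 k l m = ℤP.+-identityʳ (rhs k l m)

  holds : ∀ {a b} → a ≈ b → (a ⊕ neg b) ≈ 𝟘
  holds {a} {b} a≈b k l m rewrite a≈b k l m = ℤP.+-inverseʳ (b k l m)

  scaled : ∀ c {t} → t ≈ 𝟘 → (c ⊛ t) ≈ 𝟘
  scaled c {t} t≈0 k l m = trans (*-cong (≈-refl {c}) t≈0 k l m) (zeroʳ c k l m)

  negated : ∀ {t} → t ≈ 𝟘 → neg t ≈ 𝟘
  negated t≈0 k l m rewrite t≈0 k l m = refl

  infixr 5 _and_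
  _and_ : ∀ {s t} → s ≈ 𝟘 → t ≈ 𝟘 → (s ⊕ t) ≈ 𝟘
  (s≈0 and t≈0) k l m rewrite s≈0 k l m | t≈0 k l m = refl

module Notation (σ₁ σ₂ : Bool) {n : ℕ} (x y z b s₀₀ s₀₁ s₁₀ s₁₁ iy iz ig id : SeriesSolver.Polynomial n) where
  open import Data.Nat as ℕ using (zero; suc)
  open SeriesSolver
  open PairCounts using (stepCost; nextCarry)
  open PairSystem using (noCarry)

  one two four : Polynomial n
  one  = con (+ 1)
  two  = con (+ 2)
  four = con (+ 4)

  p ey ez g xyz d : Polynomial n
  p   = one :+ y :* z
  ey  = one :- two :* x :* y :* p
  ez  = one :- two :* x :* z :* p
  g   = one :- four :* x :* y :* z
  xyz = x :* y :* z
  d   = one :- x :* p :* p :- xyz :* iy :- xyz :* iz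

  s : Bool → Bool → Polynomial n
  s false false = s₀₀
  s false true  = s₀₁
  s true  false = s₁₀
  s true  true  = s₁₁

  private
    yPowᴾ zPowᴾ : ℕ → Polynomial n → Polynomial n
    yPowᴾ zero    e = e
    yPowᴾ (suc k) e = y :* yPowᴾ k e
    zPowᴾ zero    e = e
    zPowᴾ (suc k) e = z :* zPowᴾ k e
    Σ₂ᴾ : (Bool → Polynomial n) → Polynomial n
    Σ₂ᴾ f = f false :+ f true

  rhs : Bool → Bool → Polynomial n
  rhs c₁ c₂ = con (+ (noCarry c₁ ℕ.* noCarry c₂)) :* b :+ x :* (Σ₂ᴾ λ tb → Σ₂ᴾ λ α → Σ₂ᴾ λ β →
    yPowᴾ (stepCost σ₁ tb α c₁) (zPowᴾ (stepCost σ₂ tb β c₂) (s (nextCarry σ₁ tb α c₁) (nextCarry σ₂ tb β c₂))))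

  eq : Bool → Bool → Polynomial n
  eq c₁ c₂ = s c₁ c₂ :- rhs c₁ c₂

  eq₀₀ eq₀₁ eq₁₀ eq₁₁ : Polynomial n
  eq₀₀ = eq false false
  eq₀₁ = eq false true
  eq₁₀ = eq true false
  eq₁₁ = eq true true

  unit-y unit-z : Polynomial n
  unit-y = ey :* iy :- one
  unit-z = ez :* iz :- one

  num-A num-A′ num-A″ num-A‴ expr-A expr-A′ expr-A″ expr-A‴ : Polynomial n
  num-A  = one :- x :* y :* y :* z :* z :* ig :* (one :+ two :* x :* y :* iy :+ two :* x :* z :* iz)
  num-A′ = one :- x :* p :* p :- xyz :* iy :- xyz
  num-A″ = one :- x :* p :* p :- xyz :* iz :- xyz
  num-A‴ = one :- x :* ig :* (one :+ two :* x :* y :* y :* z :* iy :+ two :* x :* y :* z :* z :* iz)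
  expr-A  = num-A :* id
  expr-A′ = one :* iz :* (num-A′ :* id)
  expr-A″ = one :* iy :* (num-A″ :* id)
  expr-A‴ = num-A‴ :* id

module Elimination (σ₁ σ₂ : Bool) where
  open SeriesRing
  open CommutativeRing seriesRing using (zeroʳ) renaming (trans to ≈-trans)
  open SeriesSolver using (Polynomial; var; ⟦_⟧; ⟦_⟧↓; prove)
  open import Data.Vec using (Vec; []; _∷_)
  open import Data.Fin using (#_)
  open PairSystem using (PairSeries; AllYZ)

  env : Vec Series 12
  env = X ∷ Y ∷ Z ∷ AllYZ ∷ PairSeries σ₁ σ₂ false false ∷ PairSeries σ₁ σ₂ false true
      ∷ PairSeries σ₁ σ₂ true false ∷ PairSeries σ₁ σ₂ true true ∷ inv Ey ∷ inv Ez ∷ inv G ∷ inv D ∷ []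

  ⟪_⟫ : Polynomial 12 → Series
  ⟪ e ⟫ = ⟦ e ⟧ env

  divide-by : ∀ a (e r : Polynomial 12) → a 0 0 0 ≡ + 1 → (a ⊛ ⟪ e ⟫) ≈ ⟪ r ⟫ → ⟪ e ⟫ ≈ (inv a ⊛ ⟪ r ⟫)
  divide-by a e r = Inverses.divide a {⟪ e ⟫} {⟪ r ⟫}

  vanishes-by : ∀ a (e : Polynomial 12) → a 0 0 0 ≡ + 1 → (a ⊛ ⟪ e ⟫) ≈ 𝟘 → ⟪ e ⟫ ≈ 𝟘
  vanishes-by a e a₀ ae≈0 = ≈-trans (Inverses.divide a {⟪ e ⟫} {𝟘} a₀ ae≈0) (zeroʳ (inv a))

  identity : ∀ e₁ e₂ → ⟦ e₁ ⟧↓ env ≈ ⟦ e₂ ⟧↓ env → ⟪ e₁ ⟫ ≈ ⟪ e₂ ⟫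
  identity = prove env

  x y z b s₀₀ s₀₁ s₁₀ s₁₁ iy iz ig id : Polynomial 12
  x   = var (# 0)
  y   = var (# 1)
  z   = var (# 2)
  b   = var (# 3)
  s₀₀ = var (# 4)
  s₀₁ = var (# 5)
  s₁₀ = var (# 6)
  s₁₁ = var (# 7)
  iy  = var (# 8)
  iz  = var (# 9)
  ig  = var (# 10)
  id  = var (# 11)

  open Notation σ₁ σ₂ x y z b s₀₀ s₀₁ s₁₀ s₁₁ iy iz ig id public

-- The equations PairSystem.system, as vanishing expressions; splitting
-- all cases lets both sides compute to the same series.
module _ where
  open SeriesRing using (_≈_; 𝟘)
  open LinearCombinations using (holds)
  open PairSystem using (system)
  open Elimination using (⟪_⟫; eq)

  system-equation : ∀ σ₁ σ₂ c₁ c₂ → ⟪_⟫ σ₁ σ₂ (eq σ₁ σ₂ c₁ c₂) ≈ 𝟘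
  system-equation false false false false = holds (system false false false false)
  system-equation false false false true  = holds (system false false false true)
  system-equation false false true  false = holds (system false false true  false)
  system-equation false false true  true  = holds (system false false true  true)
  system-equation false true  false false = holds (system false true  false false)
  system-equation false true  false true  = holds (system false true  false true)
  system-equation false true  true  false = holds (system false true  true  false)
  system-equation false true  true  true  = holds (system false true  true  true)
  system-equation true  false false false = holds (system true  false false false)
  system-equation true  false false true  = holds (system true  false false true)
  system-equation true  false true  false = holds (system true  false true  false)
  system-equation true  false true  true  = holds (system true  false true  true)
  system-equation true  true  false false = holds (system true  true  false false)
  system-equation true  true  false true  = holds (system true  true  false true)
  system-equation true  true  true  false = holds (system true  true  true  false)
  system-equation true  true  true  true  = holds (system true  true  true  true)

module Solution-ff where
  open import Relation.Binary.PropositionalEquality using (refl)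
  open SeriesRing
  open CommutativeRing seriesRing using () renaming (refl to ≈-refl)
  open SeriesSolver using (Polynomial; _:+_; _:-_; _:*_; :-_)
  open LinearCombinations
  open Inverses
  open PairSystem using (PairSeries; AllYZ)
  open Elimination false false

  E : ∀ c₁ c₂ → ⟪ eq c₁ c₂ ⟫ ≈ 𝟘
  E = system-equation false false

  difference : ⟪ s₀₀ :- s₁₁ ⟫ ≈ ⟪ ig :* b ⟫
  difference = divide-by G (s₀₀ :- s₁₁) b refl (combination
    (identity (g :* (s₀₀ :- s₁₁)) (b :+ (eq₀₀ :- eq₁₁)) ≈-refl)
    (E false false and negated (E true true)))

  r₀₁ r₁₀ : Polynomial 12
  r₀₁ = two :* x :* y :* (s₀₀ :+ y :* z :* s₁₁)
  r₁₀ = two :* x :* z :* (s₀₀ :+ y :* z :* s₁₁)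

  carry₀₁ : ⟪ s₀₁ ⟫ ≈ ⟪ iz :* r₀₁ ⟫
  carry₀₁ = divide-by Ez s₀₁ r₀₁ refl (combination (identity (ez :* s₀₁) (r₀₁ :+ eq₀₁) ≈-refl) (E false true))

  carry₁₀ : ⟪ s₁₀ ⟫ ≈ ⟪ iy :* r₁₀ ⟫
  carry₁₀ = divide-by Ey s₁₀ r₁₀ refl (combination (identity (ey :* s₁₀) (r₁₀ :+ eq₁₀) ≈-refl) (E true false))

  main : ⟪ s₀₀ ⟫ ≈ ⟪ id :* (b :* num-A) ⟫
  main = divide-by D s₀₀ (b :* num-A) refl (combination
    (identity (d :* s₀₀)
      (b :* num-A :+ (eq₀₀ :+ (c₁ :* (s₀₁ :- iz :* r₀₁) :+ (c₂ :* (s₁₀ :- iy :* r₁₀)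
                   :+ (c₃ :* (s₀₀ :- s₁₁ :- ig :* b) :+ c₄ :* (unit-z :+ unit-y))))))
      ≈-refl)
    (E false false and scaled ⟪ c₁ ⟫ (holds carry₀₁) and scaled ⟪ c₂ ⟫ (holds carry₁₀)
      and scaled ⟪ c₃ ⟫ (holds difference) and scaled ⟪ c₄ ⟫ (holds (inv-law Ez refl) and holds (inv-law Ey refl))))
    where
    c₁ c₂ c₃ c₄ : Polynomial 12
    c₁ = x :* z :* z
    c₂ = x :* y :* y
    c₃ = :- x :* (y :* z) :* (y :* z) :* (one :+ two :* x :* z :* iz :+ two :* x :* y :* iy)
    c₄ = :- x :* y :* z :* s₀₀

  solution : PairSeries false false false false ≈ AllYZ ⊛ A
  solution = combination (identity s₀₀ (b :* expr-A :+ (s₀₀ :- id :* (b :* num-A))) ≈-refl) (holds main)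

module Solution-ft where
  open import Relation.Binary.PropositionalEquality using (refl; trans)
  open SeriesRing
  open CommutativeRing seriesRing using () renaming (refl to ≈-refl; trans to ≈-trans)
  open SeriesSolver using (Polynomial; _:+_; _:-_; _:*_; :-_)
  open LinearCombinations
  open Inverses
  open PairSystem using (PairSeries; AllYZ)
  open Elimination false true

  E : ∀ c₁ c₂ → ⟪ eq c₁ c₂ ⟫ ≈ 𝟘
  E = system-equation false true

  symmetric : ⟪ s₀₁ :- s₁₀ ⟫ ≈ 𝟘
  symmetric = vanishes-by G (s₀₁ :- s₁₀) refl (≈-trans
    (identity (g :* (s₀₁ :- s₁₀)) (eq₀₁ :- eq₁₀) ≈-refl)
    (E false true and negated (E true false)))

  r₀₀ r₁₁ : Polynomial 12
  r₀₀ = b :+ two :* x :* y :* (s₀₁ :+ y :* z :* s₁₀)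
  r₁₁ = two :* x :* z :* (s₀₁ :+ y :* z :* s₁₀)

  carry₀₀ : ⟪ s₀₀ ⟫ ≈ ⟪ iz :* r₀₀ ⟫
  carry₀₀ = divide-by Ez s₀₀ r₀₀ refl (combination (identity (ez :* s₀₀) (r₀₀ :+ eq₀₀) ≈-refl) (E false false))

  carry₁₁ : ⟪ s₁₁ ⟫ ≈ ⟪ iy :* r₁₁ ⟫
  carry₁₁ = divide-by Ey s₁₁ r₁₁ refl (combination (identity (ey :* s₁₁) (r₁₁ :+ eq₁₁) ≈-refl) (E true true))

  cross : ⟪ d :* s₀₁ ⟫ ≈ ⟪ x :* z :* z :* (iz :* b) ⟫
  cross = combination
    (identity (d :* s₀₁)
      (x :* z :* z :* (iz :* b) :+ (eq₀₁ :+ (c₁ :* (s₀₀ :- iz :* r₀₀) :+ (c₂ :* (s₁₁ :- iy :* r₁₁)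
                                 :+ (c₃ :* (s₀₁ :- s₁₀) :+ c₄ :* (unit-z :+ unit-y))))))
      ≈-refl)
    (E false true and scaled ⟪ c₁ ⟫ (holds carry₀₀) and scaled ⟪ c₂ ⟫ (holds carry₁₁)
      and scaled ⟪ c₃ ⟫ symmetric and scaled ⟪ c₄ ⟫ (holds (inv-law Ez refl) and holds (inv-law Ey refl)))
    where
    c₁ c₂ c₃ c₄ : Polynomial 12
    c₁ = x :* z :* z
    c₂ = x :* y :* y
    c₃ = :- x :* (y :* z) :* (y :* z) :* (one :+ two :* x :* z :* iz :+ two :* x :* y :* iy)
    c₄ = :- x :* y :* z :* s₀₁

  main : ⟪ s₀₀ ⟫ ≈ ⟪ id :* (b :* (iz :* num-A′)) ⟫
  main = divide-by D s₀₀ (b :* (iz :* num-A′)) refl (combination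
    (identity (d :* s₀₀)
      (b :* (iz :* num-A′) :+ (c₁ :* unit-z :+ (c₂ :* (d :* s₀₁ :- x :* z :* z :* (iz :* b))
                             :+ (c₃ :* (s₀₁ :- s₁₀) :+ d :* (s₀₀ :- iz :* r₀₀)))))
      ≈-refl)
    (scaled ⟪ c₁ ⟫ (holds (inv-law Ez refl)) and scaled ⟪ c₂ ⟫ (holds cross)
      and scaled ⟪ c₃ ⟫ symmetric and scaled ⟪ d ⟫ (holds carry₀₀)))
    where
    c₁ c₂ c₃ : Polynomial 12
    c₁ = :- x :* (y :* z) :* iz :* b
    c₂ = two :* x :* y :* p :* iz
    c₃ = :- two :* x :* y :* (y :* z) :* iz :* d

  solution : PairSeries false true false false ≈ AllYZ ⊛ A′
  solution = combination (identity s₀₀ (b :* expr-A′ :+ (s₀₀ :- id :* (b :* (iz :* num-A′)))) ≈-refl) (holds main)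

-- The system of kinds (true, false), the mirror image of (false, true)
-- under exchanging y and z: its no-carry series is AllYZ · A″.
module Solution-tf where
  open import Relation.Binary.PropositionalEquality using (refl; trans)
  open SeriesRing
  open CommutativeRing seriesRing using () renaming (refl to ≈-refl; trans to ≈-trans)
  open SeriesSolver using (Polynomial; _:+_; _:-_; _:*_; :-_)
  open LinearCombinations
  open Inverses
  open PairSystem using (PairSeries; AllYZ)
  open Elimination true false

  E : ∀ c₁ c₂ → ⟪ eq c₁ c₂ ⟫ ≈ 𝟘
  E = system-equation true false

  symmetric : ⟪ s₀₁ :- s₁₀ ⟫ ≈ 𝟘
  symmetric = vanishes-by G (s₀₁ :- s₁₀) refl (≈-trans
    (identity (g :* (s₀₁ :- s₁₀)) (eq₀₁ :- eq₁₀) ≈-refl)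
    (E false true and negated (E true false)))

  r₀₀ r₁₁ : Polynomial 12
  r₀₀ = b :+ two :* x :* z :* (s₁₀ :+ y :* z :* s₀₁)
  r₁₁ = two :* x :* y :* (s₁₀ :+ y :* z :* s₀₁)

  carry₀₀ : ⟪ s₀₀ ⟫ ≈ ⟪ iy :* r₀₀ ⟫
  carry₀₀ = divide-by Ey s₀₀ r₀₀ refl (combination (identity (ey :* s₀₀) (r₀₀ :+ eq₀₀) ≈-refl) (E false false))

  carry₁₁ : ⟪ s₁₁ ⟫ ≈ ⟪ iz :* r₁₁ ⟫
  carry₁₁ = divide-by Ez s₁₁ r₁₁ refl (combination (identity (ez :* s₁₁) (r₁₁ :+ eq₁₁) ≈-refl) (E true true))

  cross : ⟪ d :* s₁₀ ⟫ ≈ ⟪ x :* y :* y :* (iy :* b) ⟫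
  cross = combination
    (identity (d :* s₁₀)
      (x :* y :* y :* (iy :* b) :+ (eq₁₀ :+ (c₁ :* (s₀₀ :- iy :* r₀₀) :+ (c₂ :* (s₁₁ :- iz :* r₁₁)
                                 :+ (c₃ :* (s₀₁ :- s₁₀) :+ c₄ :* (unit-y :+ unit-z))))))
      ≈-refl)
    (E true false and scaled ⟪ c₁ ⟫ (holds carry₀₀) and scaled ⟪ c₂ ⟫ (holds carry₁₁)
      and scaled ⟪ c₃ ⟫ symmetric and scaled ⟪ c₄ ⟫ (holds (inv-law Ey refl) and holds (inv-law Ez refl)))
    where
    c₁ c₂ c₃ c₄ : Polynomial 12
    c₁ = x :* y :* y
    c₂ = x :* z :* z
    c₃ = x :* (y :* z) :* (y :* z) :* (one :+ two :* x :* y :* iy :+ two :* x :* z :* iz)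
    c₄ = :- x :* y :* z :* s₁₀

  main : ⟪ s₀₀ ⟫ ≈ ⟪ id :* (b :* (iy :* num-A″)) ⟫
  main = divide-by D s₀₀ (b :* (iy :* num-A″)) refl (combination
    (identity (d :* s₀₀)
      (b :* (iy :* num-A″) :+ (c₁ :* unit-y :+ (c₂ :* (d :* s₁₀ :- x :* y :* y :* (iy :* b))
                             :+ (c₃ :* (s₀₁ :- s₁₀) :+ d :* (s₀₀ :- iy :* r₀₀)))))
      ≈-refl)
    (scaled ⟪ c₁ ⟫ (holds (inv-law Ey refl)) and scaled ⟪ c₂ ⟫ (holds cross)
      and scaled ⟪ c₃ ⟫ symmetric and scaled ⟪ d ⟫ (holds carry₀₀)))
    where
    c₁ c₂ c₃ : Polynomial 12
    c₁ = :- x :* (y :* z) :* iy :* b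
    c₂ = two :* x :* z :* p :* iy
    c₃ = two :* x :* z :* (y :* z) :* iy :* d

  solution : PairSeries true false false false ≈ AllYZ ⊛ A″
  solution = combination (identity s₀₀ (b :* expr-A″ :+ (s₀₀ :- id :* (b :* (iy :* num-A″)))) ≈-refl) (holds main)

module Solution-tt where
  open import Relation.Binary.PropositionalEquality using (refl)
  open SeriesRing
  open CommutativeRing seriesRing using () renaming (refl to ≈-refl)
  open SeriesSolver using (Polynomial; _:+_; _:-_; _:*_; :-_)
  open LinearCombinations
  open Inverses
  open PairSystem using (PairSeries; AllYZ)
  open Elimination true true

  E : ∀ c₁ c₂ → ⟪ eq c₁ c₂ ⟫ ≈ 𝟘
  E = system-equation true true

  difference : ⟪ s₀₀ :- s₁₁ ⟫ ≈ ⟪ ig :* b ⟫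
  difference = divide-by G (s₀₀ :- s₁₁) b refl (combination
    (identity (g :* (s₀₀ :- s₁₁)) (b :+ (eq₀₀ :- eq₁₁)) ≈-refl)
    (E false false and negated (E true true)))

  r₀₁ r₁₀ : Polynomial 12
  r₀₁ = two :* x :* z :* (y :* z :* s₀₀ :+ s₁₁)
  r₁₀ = two :* x :* y :* (y :* z :* s₀₀ :+ s₁₁)

  carry₀₁ : ⟪ s₀₁ ⟫ ≈ ⟪ iy :* r₀₁ ⟫
  carry₀₁ = divide-by Ey s₀₁ r₀₁ refl (combination (identity (ey :* s₀₁) (r₀₁ :+ eq₀₁) ≈-refl) (E false true))

  carry₁₀ : ⟪ s₁₀ ⟫ ≈ ⟪ iz :* r₁₀ ⟫
  carry₁₀ = divide-by Ez s₁₀ r₁₀ refl (combination (identity (ez :* s₁₀) (r₁₀ :+ eq₁₀) ≈-refl) (E true false))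

  main : ⟪ s₀₀ ⟫ ≈ ⟪ id :* (b :* num-A‴) ⟫
  main = divide-by D s₀₀ (b :* num-A‴) refl (combination
    (identity (d :* s₀₀)
      (b :* num-A‴ :+ (eq₀₀ :+ (c₁ :* (s₀₁ :- iy :* r₀₁) :+ (c₂ :* (s₁₀ :- iz :* r₁₀)
                    :+ (c₃ :* (s₀₀ :- s₁₁ :- ig :* b) :+ c₄ :* (unit-y :+ unit-z))))))
      ≈-refl)
    (E false false and scaled ⟪ c₁ ⟫ (holds carry₀₁) and scaled ⟪ c₂ ⟫ (holds carry₁₀)
      and scaled ⟪ c₃ ⟫ (holds difference) and scaled ⟪ c₄ ⟫ (holds (inv-law Ey refl) and holds (inv-law Ez refl))))
    where
    c₁ c₂ c₃ c₄ : Polynomial 12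
    c₁ = x :* y :* y
    c₂ = x :* z :* z
    c₃ = :- (two :* x :* x :* (y :* z) :* (y :* iy :+ z :* iz) :+ x)
    c₄ = :- x :* y :* z :* s₀₀

  solution : PairSeries true true false false ≈ AllYZ ⊛ A‴
  solution = combination (identity s₀₀ (b :* expr-A‴ :+ (s₀₀ :- id :* (b :* num-A‴))) ≈-refl) (holds main)

module TwoGeometricSeries where
  open import Data.Nat as ℕ using (zero; suc)
  open import Relation.Binary.PropositionalEquality using (refl; trans)
  open SeriesRing
  open SeriesSolver using (solve; _:=_; _:+_; _:-_; _:*_; con)
  open CommutativeRing seriesRing using (*-cong) renaming (refl to ≈-refl; trans to ≈-trans)
  open VariableShifts
  open PairSystem using (AllYZ)
  open Inverses using (divide)

  AllY : Series
  AllY zero l zero    = + 1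
  AllY zero l (suc m) = + 0
  AllY (suc k) l m    = + 0

  telescope-z : ((𝟙 ⊖ Z) ⊛ AllYZ) ≈ AllY
  telescope-z = ≈-trans (solve 2 (λ z a → (con (+ 1) :- z) :* a := a :- z :* a) ≈-refl Z AllYZ) coefficients
    where
    coefficients : (AllYZ ⊖ Z ⊛ AllYZ) ≈ AllY
    coefficients zero    l zero    rewrite Z-⊛-zero AllYZ 0 l       = refl
    coefficients zero    l (suc m) rewrite Z-⊛-suc AllYZ 0 l m      = refl
    coefficients (suc k) l zero    rewrite Z-⊛-zero AllYZ (suc k) l = refl
    coefficients (suc k) l (suc m) rewrite Z-⊛-suc AllYZ (suc k) l m = refl

  telescope-y : ((𝟙 ⊖ Y) ⊛ AllY) ≈ 𝟙
  telescope-y = ≈-trans (solve 2 (λ y a → (con (+ 1) :- y) :* a := a :- y :* a) ≈-refl Y AllY) coefficients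
    where
    coefficients : (AllY ⊖ Y ⊛ AllY) ≈ 𝟙
    coefficients zero    zero    zero    rewrite Y-⊛-zero AllY 0 0       = refl
    coefficients zero    zero    (suc m) rewrite Y-⊛-zero AllY 0 (suc m) = refl
    coefficients zero    (suc l) zero    rewrite Y-⊛-suc AllY 0 l 0      = refl
    coefficients zero    (suc l) (suc m) rewrite Y-⊛-suc AllY 0 l (suc m) = refl
    coefficients (suc k) zero    m       rewrite Y-⊛-zero AllY (suc k) m = refl
    coefficients (suc k) (suc l) m       rewrite Y-⊛-suc AllY (suc k) l m = refl

  AllYZ-geometric : AllYZ ≈ (𝟙 ⊘ (𝟙 ⊖ Y)) ⊛ (𝟙 ⊘ (𝟙 ⊖ Z))
  AllYZ-geometric = ≈-trans
    (divide (𝟙 ⊖ Z) refl (≈-trans telescope-z (divide (𝟙 ⊖ Y) refl telescope-y)))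
    (solve 2 (λ iy iz → iz :* (iy :* con (+ 1)) := con (+ 1) :* iy :* (con (+ 1) :* iz)) ≈-refl
      (inv (𝟙 ⊖ Y)) (inv (𝟙 ⊖ Z)))

module GeneratingFunction where
  open SeriesRing
  open SeriesSolver using (solve; _:=_; _:+_; _:*_)
  open CommutativeRing seriesRing using (+-cong; *-cong; setoid) renaming (refl to ≈-refl)
  open import Relation.Binary.Reasoning.Setoid setoid
  open PairSystem using (PairSeries; AllYZ)
  open TwoGeometricSeries using (AllYZ-geometric)

  all-pairs : Series
  all-pairs = (PairSeries false false false false ⊕ PairSeries false true false false)
            ⊕ (PairSeries true false false false ⊕ PairSeries true true false false)

  all-pairs≈F : all-pairs ≈ F
  all-pairs≈F = begin
    all-pairs
      ≈⟨ +-cong (+-cong Solution-ff.solution Solution-ft.solution) (+-cong Solution-tf.solution Solution-tt.solution) ⟩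
    (AllYZ ⊛ A ⊕ AllYZ ⊛ A′) ⊕ (AllYZ ⊛ A″ ⊕ AllYZ ⊛ A‴)
      ≈⟨ solve 5 (λ b a a′ a″ a‴ → (b :* a :+ b :* a′) :+ (b :* a″ :+ b :* a‴) := b :* (a :+ a′ :+ a″ :+ a‴)) ≈-refl AllYZ A A′ A″ A‴ ⟩
    AllYZ ⊛ (A ⊕ A′ ⊕ A″ ⊕ A‴)
      ≈⟨ *-cong AllYZ-geometric (≈-refl {A ⊕ A′ ⊕ A″ ⊕ A‴}) ⟩
    F ∎

proposition6 : (k ℓ m : ℕ) → + (M2 k ℓ m) ≡ F k ℓ m
proposition6 k ℓ m =
  ≡.trans (≡.cong +_ (PaperQuantities.M2-as-Pairs k ℓ m)) (GeneratingFunction.all-pairs≈F k ℓ m)
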